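{- In the graph $\Gamma_{\{0\}}$: (i) there are no maximal cliques of size smaller than $8$; (ii) there are $3628800$ cliques of size $5$, $3628800$ cliques of size $6$, $2073600$ cliques of size $7$, and $518400$ cliques of size $8$; (iii) the group $W$ acts transitively on the set of cliques of size $5$.
   Context: $\Lambda=\{a\in \mathbb{Z}^8+\langle(\tfrac12,\ldots,\tfrac12)\rangle : \sum_i a_i\in 2\mathbb{Z}\}$ is the $E_8$ lattice and $E=\{a\in\Lambda:\|a\|=\sqrt2\}$. $\Gamma_{\{0\}}$ is the graph on $E$ whose edges join orthogonal roots; its cliques are sets of pairwise orthogonal roots, the size of a clique is its number of vertices, and maximal means maximal under inclusion. $W$ is the Weyl group of $E_8$ acting on sets of roots. -}

module Defs where

open import Data.Bool using (Bool; true; false; _∧_; _∨_; not; T)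
open import Data.Nat as ℕ using (ℕ; _≡ᵇ_; _%_)
open import Data.Integer as ℤ using (ℤ; +_; _+_; _*_; _-_; ∣_∣; _≤ᵇ_; _/_)

open import Data.List.Base using (List; []; _∷_; all; length)
open import Data.Vec using (Vec; []; _∷_; zipWith; foldr; toList)
open import Data.Product using (Σ)
open import Relation.Nullary.Decidable using (does)

-- ENCODING: a vector x : V8 (integer coordinates) represents the point x/2 ∈ ℝ^8.
-- Thus half-integer points of ℝ^8 correspond exactly to integer vectors x.
V8 : Set
V8 = Vec ℤ 8

infix 4 _==_
_==_ : ℤ → ℤ → Bool
i == j = does (i ℤ.≟ j)

isEven : ℤ → Bool
isEven i = (∣ i ∣ % 2) ≡ᵇ 0

sumV : ∀ {n} → Vec ℤ n → ℤ
sumV = foldr _ _+_ (+ 0)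

-- standard inner product of the integer vectors x, y
-- (the inner product of the represented points x/2, y/2 is  dot x y / 4)
dot : ∀ {n} → Vec ℤ n → Vec ℤ n → ℤ
dot x y = sumV (zipWith _*_ x y)

-- x/2 ∈ Λ  iff  x/2 ∈ ℤ^8 ∪ (ℤ^8 + (1/2,…,1/2))  and  Σ (x_i/2) ∈ 2ℤ,
-- i.e. all x_i even or all x_i odd, and Σ x_i ≡ 0 (mod 4).
inΛ : V8 → Bool
inΛ x = (all isEven xs ∨ all (λ i → not (isEven i)) xs) ∧ ((∣ sumV x ∣ % 4) ≡ᵇ 0)
  where xs = toList x

-- x/2 ∈ E  iff  x/2 ∈ Λ and ‖x/2‖² = 2, i.e. dot x x = 8.
isRoot : V8 → Bool
isRoot x = inΛ x ∧ (dot x x == + 8)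

orth : V8 → V8 → Bool
orth x y = dot x y == + 0

pairwiseOrth : List V8 → Bool
pairwiseOrth []       = true
pairwiseOrth (x ∷ xs) = all (orth x) xs ∧ pairwiseOrth xs

-- a list of roots that is a clique of Γ_{0} (pairwise orthogonal roots;
-- orthogonality forces the entries to be distinct, so the size of the
-- clique is the length of the list)
isClique : List V8 → Bool
isClique l = all isRoot l ∧ pairwiseOrth l

-- strict lexicographic order on integer vectors (used only to give each
-- finite set of roots a unique canonical list representation)
ltLex : ∀ {n} → Vec ℤ n → Vec ℤ n → Bool
ltLex []       []       = false
ltLex (a ∷ as) (b ∷ bs) = ((a ≤ᵇ b) ∧ not (a == b)) ∨ ((a == b) ∧ ltLex as bs)

strictlySorted : List V8 → Bool
strictlySorted []           = true
strictlySorted (x ∷ [])     = true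
strictlySorted (x ∷ y ∷ zs) = ltLex x y ∧ strictlySorted (y ∷ zs)

-- The type of cliques of Γ_{0} of size k, each clique (a finite set of roots)
-- represented by its unique strictly increasing list.
Clique : ℕ → Set
Clique k = Σ (List V8) (λ l → T (strictlySorted l ∧ isClique l ∧ (length l ≡ᵇ k)))

open import Data.List.Membership.Propositional using (_∈_)
open import Data.List.Relation.Unary.All using (All)

Maximal : List V8 → Set
Maximal C = (r : V8) → T (isRoot r) → All (λ c → T (orth r c)) C → r ∈ C

-- Reflection s_a(v) = v - 2 (v·a)/(a·a) a for a root a (a·a = 2) in doubled
-- coordinates: with V = 2v, A = 2a this is V - ((V·A)/4) A.  (For V, A in 2Λ
-- the division is exact, since Λ is integral.)
reflect : V8 → V8 → V8
reflect a v = zipWith (λ vi ai → vi - q * ai) v a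
  where q = dot v a / (+ 4)

-- The element of W given by a word of root reflections  s_{a1} ∘ … ∘ s_{am}.
-- W is generated by the reflections s_a, a ∈ E, and each generator is an
-- involution, so every element of W is of this form.
actW : List V8 → V8 → V8
actW []       v = v
actW (a ∷ as) v = reflect a (actW as v)

SameSet : List V8 → List V8 → Set
SameSet xs ys = (x : V8) → (x ∈ xs → x ∈ ys) Data.Product.× (x ∈ ys → x ∈ xs)

-- W preserves orthogonality, so the theorem reduces to a finite certificate: a table of
-- representatives P of the W-orbits of ordered cliques (sequences of pairwise orthogonal roots).
-- For each P and each root r orthogonal to P the table gives a word in reflections that fixes P
-- pointwise and moves r to one of finitely many extensions e, and P ∷ʳ e is again in the table.
-- Following the table moves every clique onto a representative. Representatives with fewer
-- than 8 roots have an extension, so no such clique is maximal; each representative with 5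
-- roots is mapped by a stored word onto one standard 5-clique, so W is transitive on 5-cliques.
-- The stabilisers of the first three representatives (), (e₁), (e₁, e₂) act transitively on the
-- roots orthogonal to them, so double counting gives k · N_k(L) = |L| · N_{k-1}(L ∩ e^⊥) on the
-- successive orthogonal complements, of sizes 240, 126 and 60; the last one is counted directly.

module Submission where

open import Defs
open import Data.Bool using (T)
open import Data.Nat using (_<_)
open import Data.List.Base using (List; length; all; map)
open import Data.Fin using (Fin)
open import Data.Product using (_×_; Σ)
open import Relation.Nullary using (¬_)
open import Relation.Binary.PropositionalEquality using (_≡_)
open import Function.Bundles using (_↔_)

open import Data.Bool using (Bool; true; false; _∧_; _∨_; not; if_then_else_)
open import Data.Bool.Properties using (T-∧; T-≡; T-irrelevant)
import Data.Bool.ListAction as Bool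
open import Data.Empty using (⊥; ⊥-elim)
open import Data.List using ([]; _∷_; _∷ʳ_; _++_; filterᵇ; null)
import Data.List.Properties as List
open import Data.List.Membership.Propositional using (_∈_; find)
open import Data.List.Membership.Propositional.Properties using (∈-map⁺; ∈-map⁻; ∈-filter⁺; ∈-filter⁻)
open import Data.List.Relation.Binary.Permutation.Propositional as ↭ using (_↭_)
open import Data.List.Relation.Unary.All as All using (All; []; _∷_)
open import Data.List.Relation.Unary.All.Properties using (all⁺; all⁻; map⁺; ++⁺; ++⁻ˡ; ++⁻ʳ; filter⁺)
open import Data.List.Relation.Unary.AllPairs using (AllPairs; []; _∷_)
open import Data.List.Relation.Unary.Any as Any using (Any; here; there)
open import Data.List.Relation.Unary.Any.Properties using (any⁻)
import Data.Nat.Properties as ℕ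
open import Data.Product using (_,_; proj₁; proj₂)
open import Data.Sum using (_⊎_; inj₁; inj₂)
open import Data.Vec using (Vec; []; _∷_)
open import Function using (_∘_; Equivalence)
open import Relation.Binary.PropositionalEquality using (refl; sym; trans; cong; cong₂; subst; module ≡-Reasoning)
open import Relation.Nullary.Decidable using (T?; isYes; toWitness)

module Lists where

  open import Data.List.Membership.Propositional.Properties.WithK using (unique∧set⇒bag)
  open import Data.List.Relation.Binary.BagAndSetEquality using (∼bag⇒↭)
  open import Data.List.Relation.Unary.Unique.Propositional using (Unique)
  open import Function using (mk⇔)

  ¬T⇒≡false : ∀ {b} → ¬ T b → b ≡ false
  ¬T⇒≡false {false} _  = refl
  ¬T⇒≡false {true}  ¬t = ⊥-elim (¬t _)

  all-lookup : ∀ {A : Set} (p : A → Bool) {xs x} → T (Bool.all p xs) → x ∈ xs → T (p x)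
  all-lookup p {xs} t = All.lookup (all⁺ p xs t)

  -- The two large computations below are stated as Boolean equations proved by refl:
  -- Agda then evaluates them once, whereas T (Bool.all p xs) keeps being re-reduced.
  all-lookup≡ : ∀ {A : Set} (p : A → Bool) {xs x} → Bool.all p xs ≡ true → x ∈ xs → p x ≡ true
  all-lookup≡ p {y ∷ ys} e x∈ with p y in py
  all-lookup≡ p {y ∷ ys} e (here refl) | true = py
  all-lookup≡ p {y ∷ ys} e (there x∈) | true = all-lookup≡ p e x∈

  any-find : ∀ {A : Set} (p : A → Bool) {xs} → T (Bool.any p xs) → Σ A λ x → x ∈ xs × T (p x)
  any-find p {xs} t = find (any⁻ p xs t)

  filterᵇ-comm : ∀ {A : Set} (p q : A → Bool) (xs : List A) →
    filterᵇ p (filterᵇ q xs) ≡ filterᵇ q (filterᵇ p xs)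
  filterᵇ-comm p q [] = refl
  filterᵇ-comm p q (x ∷ xs) with p x in px | q x in qx
  ... | true  | true  rewrite px | qx = cong (x ∷_) (filterᵇ-comm p q xs)
  ... | true  | false rewrite qx      = filterᵇ-comm p q xs
  ... | false | true  rewrite px      = filterᵇ-comm p q xs
  ... | false | false                 = filterᵇ-comm p q xs

  map-unique : ∀ {A : Set} {f : A → A} {L : List A} →
    (∀ {x y} → x ∈ L → y ∈ L → f x ≡ f y → x ≡ y) → Unique L → Unique (map f L)
  map-unique {L = []}            inj []         = []
  map-unique {f = f} {L = x ∷ L} inj (x∉L ∷ uL) =
    All.tabulate (λ {z} z∈fL fx≡z → let (y , y∈L , z≡fy) = ∈-map⁻ f z∈fL in
      All.lookup x∉L y∈L (inj (here refl) (there y∈L) (trans fx≡z z≡fy)))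
    ∷ map-unique (λ x∈ y∈ → inj (there x∈) (there y∈)) uL

  map-↭-self : ∀ {A : Set} {f g : A → A} {L : List A} → Unique L →
    (∀ {x} → x ∈ L → f x ∈ L) → (∀ {x} → x ∈ L → g x ∈ L) →
    (∀ {x} → x ∈ L → g (f x) ≡ x) → (∀ {x} → x ∈ L → f (g x) ≡ x) → map f L ↭ L
  map-↭-self {f = f} {g} {L} uL f∈ g∈ gf fg = ∼bag⇒↭ (unique∧set⇒bag (map-unique injective uL) uL
    (mk⇔ (λ y∈fL → let (x , x∈L , y≡fx) = ∈-map⁻ f y∈fL in subst (_∈ L) (sym y≡fx) (f∈ x∈L))
         (λ y∈L → subst (_∈ map f L) (fg y∈L) (∈-map⁺ f (g∈ y∈L)))))
    where
    injective : ∀ {x y} → x ∈ L → y ∈ L → f x ≡ f y → x ≡ y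
    injective x∈ y∈ fx≡fy = trans (sym (gf x∈)) (trans (cong g fx≡fy) (gf y∈))

open Lists

module ListCliques {A : Set} (adj : A → A → Bool) where

  open import Algebra.Properties.CommutativeSemigroup ℕ.+-commutativeSemigroup
    using () renaming (interchange to +-interchange; x∙yz≈y∙xz to +-left-comm)
  open import Data.Fin.Properties using (+↔⊎; 0↔⊥; 1↔⊤)
  open import Data.List.Relation.Binary.Permutation.Propositional.Properties using (filter-↭)
  import Data.List.Relation.Unary.AllPairs.Properties as AllPairs
  open import Data.Nat using (ℕ; zero; suc; _+_; _*_)
  open import Data.Nat.ListAction using (sum)
  open import Data.Sum.Function.Propositional using (_⊎-↔_)
  open import Data.Unit using (⊤; tt)
  open import Function using (mk↔ₛ′)
  open import Function.Construct.Composition using (_↔-∘_)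
  open import Relation.Binary.Definitions using (Transitive)

  private
    sum-map-+ : (f g : A → ℕ) (xs : List A) →
      sum (map (λ x → f x + g x) xs) ≡ sum (map f xs) + sum (map g xs)
    sum-map-+ f g [] = refl
    sum-map-+ f g (x ∷ xs) rewrite sum-map-+ f g xs = +-interchange (f x) (g x) _ _

    sum-map-if : (p : A → Bool) (f : A → ℕ) (xs : List A) →
      sum (map (λ x → if p x then f x else 0) xs) ≡ sum (map f (filterᵇ p xs))
    sum-map-if p f [] = refl
    sum-map-if p f (x ∷ xs) with p x
    ... | true  = cong (f x +_) (sum-map-if p f xs)
    ... | false = sum-map-if p f xs

    sum-map-cong : {f g : A → ℕ} (xs : List A) → All (λ x → f x ≡ g x) xs →
      sum (map f xs) ≡ sum (map g xs)
    sum-map-cong [] [] = refl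
    sum-map-cong (x ∷ xs) (e ∷ es) = cong₂ _+_ e (sum-map-cong xs es)

    sum-map-const : {f : A → ℕ} (c : ℕ) (xs : List A) → All (λ x → f x ≡ c) xs →
      sum (map f xs) ≡ length xs * c
    sum-map-const c [] [] = refl
    sum-map-const c (x ∷ xs) (e ∷ es) = cong₂ _+_ e (sum-map-const c xs es)

  Adjacent : A → A → Set
  Adjacent x y = T (adj x y)

  neighbours : A → List A → List A
  neighbours x = filterᵇ (adj x)

  neighbours-∷ : ∀ x y L →
    neighbours x (y ∷ L) ≡ (if adj x y then y ∷ neighbours x L else neighbours x L)
  neighbours-∷ x y L with adj x y
  ... | true  = refl
  ... | false = refl

  ∈-neighbours⁻ : ∀ {x y} L → y ∈ neighbours x L → y ∈ L × Adjacent x y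
  ∈-neighbours⁻ {x} L = ∈-filter⁻ (T? ∘ adj x) {xs = L}

  ∈-neighbours⁺ : ∀ {x y} L → y ∈ L → Adjacent x y → y ∈ neighbours x L
  ∈-neighbours⁺ {x} L = ∈-filter⁺ (T? ∘ adj x) {xs = L}

  Choice : ℕ → List A → Set
  Choice zero    _       = ⊤
  Choice (suc k) []      = ⊥
  Choice (suc k) (x ∷ L) = Choice k (neighbours x L) ⊎ Choice (suc k) L

  cliqueCount : ℕ → List A → ℕ
  cliqueCount zero    _       = 1
  cliqueCount (suc k) []      = 0
  cliqueCount (suc k) (x ∷ L) = cliqueCount k (neighbours x L) + cliqueCount (suc k) L

  Fin-cliqueCount↔Choice : ∀ k L → Fin (cliqueCount k L) ↔ Choice k L
  Fin-cliqueCount↔Choice zero    L       = 1↔⊤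
  Fin-cliqueCount↔Choice (suc k) []      = 0↔⊥
  Fin-cliqueCount↔Choice (suc k) (x ∷ L) =
    (Fin-cliqueCount↔Choice k (neighbours x L) ⊎-↔ Fin-cliqueCount↔Choice (suc k) L) ↔-∘ +↔⊎

  chosen : ∀ k L → Choice k L → List A
  chosen zero    L       _        = []
  chosen (suc k) (x ∷ L) (inj₁ c) = x ∷ chosen k (neighbours x L) c
  chosen (suc k) (x ∷ L) (inj₂ c) = chosen (suc k) L c

  chosen-length : ∀ k L (c : Choice k L) → length (chosen k L c) ≡ k
  chosen-length zero    L       c        = refl
  chosen-length (suc k) (x ∷ L) (inj₁ c) = cong suc (chosen-length k (neighbours x L) c)
  chosen-length (suc k) (x ∷ L) (inj₂ c) = chosen-length (suc k) L c

  chosen-⊆ : ∀ k L (c : Choice k L) → All (_∈ L) (chosen k L c)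
  chosen-⊆ zero    L       c        = []
  chosen-⊆ (suc k) (x ∷ L) (inj₁ c) =
    here refl ∷ All.map (there ∘ proj₁ ∘ ∈-neighbours⁻ L) (chosen-⊆ k (neighbours x L) c)
  chosen-⊆ (suc k) (x ∷ L) (inj₂ c) = All.map there (chosen-⊆ (suc k) L c)

  chosen-clique : ∀ k L (c : Choice k L) → AllPairs Adjacent (chosen k L c)
  chosen-clique zero    L       c        = []
  chosen-clique (suc k) (x ∷ L) (inj₁ c) =
    All.map (proj₂ ∘ ∈-neighbours⁻ L) (chosen-⊆ k (neighbours x L) c)
      ∷ chosen-clique k (neighbours x L) c
  chosen-clique (suc k) (x ∷ L) (inj₂ c) = chosen-clique (suc k) L c

  neighbours-↭ : ∀ x {L M} → L ↭ M → neighbours x L ↭ neighbours x M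
  neighbours-↭ x = filter-↭ (T? ∘ adj x)

  commonNeighbours : List A → List A → List A
  commonNeighbours L []      = L
  commonNeighbours L (e ∷ P) = commonNeighbours (neighbours e L) P

  commonNeighbours-∷ʳ : ∀ L P e → commonNeighbours L (P ∷ʳ e) ≡ neighbours e (commonNeighbours L P)
  commonNeighbours-∷ʳ L []      e = refl
  commonNeighbours-∷ʳ L (p ∷ P) e = commonNeighbours-∷ʳ (neighbours p L) P e

  ∈-commonNeighbours⁻ : ∀ L P {x} → x ∈ commonNeighbours L P → x ∈ L × All (λ p → Adjacent p x) P
  ∈-commonNeighbours⁻ L []      x∈ = x∈ , []
  ∈-commonNeighbours⁻ L (p ∷ P) x∈ =
    let (x∈pL , P~x) = ∈-commonNeighbours⁻ (neighbours p L) P x∈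
        (x∈L , p~x)  = ∈-neighbours⁻ L x∈pL
    in x∈L , p~x ∷ P~x

  ∈-commonNeighbours⁺ : ∀ L P {x} → x ∈ L → All (λ p → Adjacent p x) P → x ∈ commonNeighbours L P
  ∈-commonNeighbours⁺ L []      x∈L []           = x∈L
  ∈-commonNeighbours⁺ L (p ∷ P) x∈L (p~x ∷ P~x) =
    ∈-commonNeighbours⁺ (neighbours p L) P (∈-neighbours⁺ L x∈L p~x) P~x

  commonNeighbours-↭ : ∀ P {L M} → L ↭ M → commonNeighbours L P ↭ commonNeighbours M P
  commonNeighbours-↭ []      L↭M = L↭M
  commonNeighbours-↭ (e ∷ P) L↭M = commonNeighbours-↭ P (neighbours-↭ e L↭M)

  module _ {Q : A → Set} (f : A → A) (f-adj : ∀ {x y} → Q x → Q y → adj (f x) (f y) ≡ adj x y) where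

    neighbours-map : ∀ {x} → Q x → ∀ {L} → All Q L → neighbours (f x) (map f L) ≡ map f (neighbours x L)
    neighbours-map {x} qx {[]}    []         = refl
    neighbours-map {x} qx {y ∷ L} (qy ∷ qL)
      rewrite neighbours-∷ (f x) (f y) (map f L) | neighbours-∷ x y L | f-adj qx qy with adj x y
    ... | true  = cong (f y ∷_) (neighbours-map qx qL)
    ... | false = neighbours-map qx qL

    cliqueCount-map : ∀ k {L} → All Q L → cliqueCount k (map f L) ≡ cliqueCount k L
    cliqueCount-map zero    _          = refl
    cliqueCount-map (suc k) {[]}    [] = refl
    cliqueCount-map (suc k) {x ∷ L} (qx ∷ qL) = cong₂ _+_
      (trans (cong (cliqueCount k) (neighbours-map qx qL)) (cliqueCount-map k (filter⁺ (T? ∘ adj x) qL)))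
      (cliqueCount-map (suc k) qL)

    commonNeighbours-map : ∀ {P L} → All Q P → All Q L →
      commonNeighbours (map f L) (map f P) ≡ map f (commonNeighbours L P)
    commonNeighbours-map {[]}    []         qL = refl
    commonNeighbours-map {e ∷ P} {L} (qe ∷ qP) qL =
      trans (cong (λ M → commonNeighbours M (map f P)) (neighbours-map qe qL))
            (commonNeighbours-map qP (filter⁺ (T? ∘ adj e) qL))

    commonNeighbours-automorphism : ∀ {P L} → All Q P → All Q L → map f P ≡ P → map f L ↭ L →
      map f (commonNeighbours L P) ↭ commonNeighbours L P
    commonNeighbours-automorphism {P} {L} qP qL fP≡P fL↭L = ↭.↭-trans
      (↭.↭-reflexive (trans (sym (commonNeighbours-map qP qL)) (cong (commonNeighbours (map f L)) fP≡P)))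
      (commonNeighbours-↭ P fL↭L)

  module _ (adj-sym : ∀ x y → adj x y ≡ adj y x) where

    cliqueCount-swap : ∀ k x y L → cliqueCount k (x ∷ y ∷ L) ≡ cliqueCount k (y ∷ x ∷ L)
    cliqueCount-swap zero    x y L = refl
    cliqueCount-swap (suc j) x y L
      rewrite neighbours-∷ x y L | neighbours-∷ y x L | adj-sym y x with adj x y
    ... | false = +-left-comm (cliqueCount j (neighbours x L)) (cliqueCount j (neighbours y L)) _
    ... | true  = adjacentPair j
      where
      adjacentPair : ∀ j →
        cliqueCount j (y ∷ neighbours x L) + (cliqueCount j (neighbours y L) + cliqueCount (suc j) L)
          ≡ cliqueCount j (x ∷ neighbours y L) + (cliqueCount j (neighbours x L) + cliqueCount (suc j) L)
      adjacentPair zero    = refl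
      adjacentPair (suc i) rewrite filterᵇ-comm (adj y) (adj x) L =
        +-interchange (cliqueCount i (neighbours x (neighbours y L))) _ _ _

    cliqueCount-↭ : ∀ k {L M} → L ↭ M → cliqueCount k L ≡ cliqueCount k M
    cliqueCount-↭ zero    _              = refl
    cliqueCount-↭ (suc k) ↭.refl         = refl
    cliqueCount-↭ (suc k) (↭.prep x p)   =
      cong₂ _+_ (cliqueCount-↭ k (neighbours-↭ x p)) (cliqueCount-↭ (suc k) p)
    cliqueCount-↭ (suc k) (↭.swap x y p) = trans (cliqueCount-swap (suc k) x y _)
      (cong₂ _+_ (cliqueCount-↭ k (neighbours-↭ y (↭.prep x p)))
                 (cong₂ _+_ (cliqueCount-↭ k (neighbours-↭ x p)) (cliqueCount-↭ (suc k) p)))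
    cliqueCount-↭ (suc k) (↭.trans p q)  = trans (cliqueCount-↭ (suc k) p) (cliqueCount-↭ (suc k) q)

    neighbourCliqueSum : ℕ → List A → ℕ
    neighbourCliqueSum j L = sum (map (λ x → cliqueCount j (neighbours x L)) L)

    Irreflexive : List A → Set
    Irreflexive = All (λ x → ¬ Adjacent x x)

    neighbourCliqueSum-doubleCounting : ∀ j L → Irreflexive L →
      neighbourCliqueSum j L ≡ suc j * cliqueCount (suc j) L
    neighbourCliqueSum-doubleCounting zero    []      _          = refl
    neighbourCliqueSum-doubleCounting zero    (x ∷ L) (_ ∷ irr)  =
      cong suc (neighbourCliqueSum-doubleCounting zero L irr)
    neighbourCliqueSum-doubleCounting (suc i) []      _          = sym (ℕ.*-zeroʳ (suc (suc i)))
    neighbourCliqueSum-doubleCounting (suc i) (x ∷ L) (xx ∷ irr) = begin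
      cliqueCount (suc i) (neighbours x (x ∷ L)) + sum (map (λ r → cliqueCount (suc i) (neighbours r (x ∷ L))) L)
        ≡⟨ cong₂ _+_ (cong (cliqueCount (suc i)) loopless) (sum-map-cong L (All.universal splitAt-x L)) ⟩
      a + sum (map (λ r → (if adj x r then cliqueCount i (neighbours r (neighbours x L)) else 0)
                          + cliqueCount (suc i) (neighbours r L)) L)
        ≡⟨ cong (a +_) (trans (sum-map-+ _ _ L)
             (cong (_+ neighbourCliqueSum (suc i) L) (sum-map-if (adj x) _ L))) ⟩
      a + (neighbourCliqueSum i (neighbours x L) + neighbourCliqueSum (suc i) L)
        ≡⟨ cong (a +_) (cong₂ _+_ (neighbourCliqueSum-doubleCounting i (neighbours x L) (filter⁺ (T? ∘ adj x) irr))
                                  (neighbourCliqueSum-doubleCounting (suc i) L irr)) ⟩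
      a + (suc i * a + suc (suc i) * b)
        ≡⟨ sym (ℕ.+-assoc a (suc i * a) _) ⟩
      suc (suc i) * a + suc (suc i) * b
        ≡⟨ sym (ℕ.*-distribˡ-+ (suc (suc i)) a b) ⟩
      suc (suc i) * (a + b) ∎
      where
      open ≡-Reasoning
      a = cliqueCount (suc i) (neighbours x L)
      b = cliqueCount (suc (suc i)) L
      loopless : neighbours x (x ∷ L) ≡ neighbours x L
      loopless rewrite neighbours-∷ x x L | ¬T⇒≡false xx = refl
      splitAt-x : ∀ r → cliqueCount (suc i) (neighbours r (x ∷ L))
        ≡ (if adj x r then cliqueCount i (neighbours r (neighbours x L)) else 0) + cliqueCount (suc i) (neighbours r L)
      splitAt-x r rewrite neighbours-∷ r x L | adj-sym r x with adj x r
      ... | true  = cong (λ M → cliqueCount i M + _) (filterᵇ-comm (adj x) (adj r) L)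
      ... | false = refl

    cliqueCount-vertexTransitive : ∀ j L e → Irreflexive L →
      All (λ x → cliqueCount j (neighbours x L) ≡ cliqueCount j (neighbours e L)) L →
      suc j * cliqueCount (suc j) L ≡ length L * cliqueCount j (neighbours e L)
    cliqueCount-vertexTransitive j L e irr hom =
      trans (sym (neighbourCliqueSum-doubleCounting j L irr)) (sum-map-const _ L hom)

    cliqueCount-neighbours-invariant : ∀ {Q : A → Set} (f : A → A) →
      (∀ {x y} → Q x → Q y → adj (f x) (f y) ≡ adj x y) →
      ∀ j {L} → All Q L → map f L ↭ L → ∀ {x} → Q x →
      cliqueCount j (neighbours x L) ≡ cliqueCount j (neighbours (f x) L)
    cliqueCount-neighbours-invariant f f-adj j {L} qL perm {x} qx = begin
      cliqueCount j (neighbours x L)             ≡⟨ sym (cliqueCount-map f f-adj j (filter⁺ (T? ∘ adj x) qL)) ⟩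
      cliqueCount j (map f (neighbours x L))     ≡⟨ cong (cliqueCount j) (sym (neighbours-map f f-adj qx qL)) ⟩
      cliqueCount j (neighbours (f x) (map f L)) ≡⟨ cliqueCount-↭ j (neighbours-↭ (f x) perm) ⟩
      cliqueCount j (neighbours (f x) L)         ∎
      where open ≡-Reasoning

  module _ {_≺_ : A → A → Set} (<-trans : Transitive _≺_) (<-irrefl : ∀ {x} → ¬ x ≺ x) where

    private
      ∈-tail : ∀ {x z L} → x ≺ z → z ∈ x ∷ L → z ∈ L
      ∈-tail x<z (here refl) = ⊥-elim (<-irrefl x<z)
      ∈-tail x<z (there z∈L) = z∈L

    chosen-sorted : ∀ k L → AllPairs _≺_ L → (c : Choice k L) → AllPairs _≺_ (chosen k L c)
    chosen-sorted zero    L       _          c        = []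
    chosen-sorted (suc k) (x ∷ L) (x<L ∷ sL) (inj₁ c) =
      All.map (All.lookup x<L ∘ proj₁ ∘ ∈-neighbours⁻ L) (chosen-⊆ k (neighbours x L) c)
        ∷ chosen-sorted k (neighbours x L) (AllPairs.filter⁺ (T? ∘ adj x) sL) c
    chosen-sorted (suc k) (x ∷ L) (_ ∷ sL)   (inj₂ c) = chosen-sorted (suc k) L sL c

    choose : ∀ k L l → AllPairs _≺_ L → AllPairs _≺_ l → All (_∈ L) l → AllPairs Adjacent l →
      length l ≡ k → Choice k L
    choose zero    L       []       _          _            _               _           _   = tt
    choose (suc k) (x ∷ L) (.x ∷ l) (_ ∷ sL)   (x<l ∷ sl)   (here refl ∷ l⊆) (x~l ∷ cl) len =
      inj₁ (choose k (neighbours x L) l (AllPairs.filter⁺ (T? ∘ adj x) sL) sl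
        (All.zipWith (λ (x<z , z∈xL , x~z) → ∈-neighbours⁺ L (∈-tail x<z z∈xL) x~z)
          (x<l , All.zip (l⊆ , x~l)))
        cl (ℕ.suc-injective len))
    choose (suc k) (x ∷ L) (y ∷ l)  (x<L ∷ sL) (y<l ∷ sl)   (there y∈L ∷ l⊆) cl         len =
      inj₂ (choose (suc k) L (y ∷ l) sL (y<l ∷ sl)
        (y∈L ∷ All.zipWith (λ (y<z , z∈xL) → ∈-tail (<-trans (All.lookup x<L y∈L) y<z) z∈xL) (y<l , l⊆))
        cl len)

    chosen-choose : ∀ k L l sL sl l⊆ cl len → chosen k L (choose k L l sL sl l⊆ cl len) ≡ l
    chosen-choose zero    L       []      _        _        _                _  _ = refl
    chosen-choose (suc k) (x ∷ L) (.x ∷ l) (_ ∷ sL) (_ ∷ sl) (here refl ∷ _) (_ ∷ cl) len =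
      cong (x ∷_) (chosen-choose k (neighbours x L) l _ sl _ cl _)
    chosen-choose (suc k) (x ∷ L) (y ∷ l)  (_ ∷ sL) (y<l ∷ sl) (there _ ∷ _) cl len =
      chosen-choose (suc k) L (y ∷ l) sL (y<l ∷ sl) _ cl len

    choose-chosen : ∀ k L (sL : AllPairs _≺_ L) (c : Choice k L) {l} → chosen k L c ≡ l →
      ∀ sl l⊆ cl len → choose k L l sL sl l⊆ cl len ≡ c
    choose-chosen zero    L       sL         c        refl sl l⊆ cl len = refl
    choose-chosen (suc k) (x ∷ L) (x<L ∷ sL) (inj₁ c) refl (_ ∷ sl) (here refl ∷ _) (_ ∷ cl) len =
      cong inj₁ (choose-chosen k (neighbours x L) _ c refl sl _ cl _)
    choose-chosen (suc k) (x ∷ L) (x<L ∷ sL) (inj₁ c) refl sl (there x∈L ∷ _) cl len =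
      ⊥-elim (<-irrefl (All.lookup x<L x∈L))
    choose-chosen (suc k) (x ∷ L) (x<L ∷ sL) (inj₂ c) {.x ∷ l} e sl (here refl ∷ _) cl len =
      ⊥-elim (<-irrefl (All.lookup x<L (All.head (subst (All (_∈ L)) e (chosen-⊆ (suc k) L c)))))
    choose-chosen (suc k) (x ∷ L) (x<L ∷ sL) (inj₂ c) {y ∷ l} e (y<l ∷ sl) (there _ ∷ _) cl len =
      cong inj₂ (choose-chosen (suc k) L sL c e (y<l ∷ sl) _ cl len)
    choose-chosen (suc k) (x ∷ L) sL         (inj₂ c) {[]} e sl l⊆ cl ()

    Choice↔sortedCliques : ∀ k L → AllPairs _≺_ L → (P : List A → Set) → (∀ {l} (p q : P l) → p ≡ q) →
      (∀ {l} → P l → AllPairs _≺_ l × All (_∈ L) l × AllPairs Adjacent l × length l ≡ k) →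
      (∀ {l} → AllPairs _≺_ l → All (_∈ L) l → AllPairs Adjacent l → length l ≡ k → P l) →
      Choice k L ↔ Σ (List A) P
    Choice↔sortedCliques k L sL P P-irr P⇒ ⇒P = mk↔ₛ′ to from to∘from from∘to
      where
      to : Choice k L → Σ (List A) P
      to c = chosen k L c , ⇒P (chosen-sorted k L sL c) (chosen-⊆ k L c) (chosen-clique k L c) (chosen-length k L c)
      from : Σ (List A) P → Choice k L
      from (l , p) = let (sl , l⊆ , cl , len) = P⇒ p in choose k L l sL sl l⊆ cl len
      to∘from : ∀ lp → to (from lp) ≡ lp
      to∘from (l , p) = Σ-irrelevant _ p (chosen-choose k L l sL _ _ _ _)
        where
        Σ-irrelevant : ∀ {l l'} (p : P l) (q : P l') → l ≡ l' → (l , p) ≡ (l' , q)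
        Σ-irrelevant p q refl = cong (_ ,_) (P-irr p q)
      from∘to : ∀ c → from (to c) ≡ c
      from∘to c = choose-chosen k L sL c refl _ _ _ _


module LexOrder where

  open import Data.Integer as ℤ using (ℤ; _≤ᵇ_)
  import Data.Integer.Properties as ℤ
  open import Data.List.Relation.Unary.Linked using (Linked; []; [-]; _∷_)
  open import Data.List.Relation.Unary.Linked.Properties using (AllPairs⇒Linked; Linked⇒AllPairs)
  open import Relation.Binary.Definitions using (tri<; tri≈; tri>)
  open import Relation.Nullary.Decidable using (dec-true; dec-false; yes; no)

  ==⇒≡ : ∀ {a b} → T (a == b) → a ≡ b
  ==⇒≡ {a} {b} t with a ℤ.≟ b
  ... | yes a≡b = a≡b

  record _<ₗ_ {n} (x y : Vec ℤ n) : Set where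
    constructor lex
    field lexLess : T (ltLex x y)

  private
    ==-refl : ∀ a → (a == a) ≡ true
    ==-refl a = dec-true (a ℤ.≟ a) refl

    ≤ᵇ-refl : ∀ a → (a ≤ᵇ a) ≡ true
    ≤ᵇ-refl a = Equivalence.to T-≡ (ℤ.≤⇒≤ᵇ {a} ℤ.≤-refl)

  <ₗ-head : ∀ {n a b} {as bs : Vec ℤ n} → a ℤ.< b → (a ∷ as) <ₗ (b ∷ bs)
  <ₗ-head {a = a} {b} {as} {bs} a<b = lex head
    where
    head : T (ltLex (a ∷ as) (b ∷ bs))
    head rewrite dec-false (a ℤ.≟ b) (ℤ.<⇒≢ a<b) | Equivalence.to T-≡ (ℤ.≤⇒≤ᵇ {a} {b} (ℤ.<⇒≤ a<b)) = _

  <ₗ-tail : ∀ {n a} {as bs : Vec ℤ n} → (a ∷ as) <ₗ (a ∷ bs) → as <ₗ bs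
  <ₗ-tail {a = a} (lex lt) rewrite ==-refl a | ≤ᵇ-refl a = lex lt

  <ₗ-tail⁻ : ∀ {n a} {as bs : Vec ℤ n} → as <ₗ bs → (a ∷ as) <ₗ (a ∷ bs)
  <ₗ-tail⁻ {a = a} {as} {bs} (lex lt) = lex tail
    where
    tail : T (ltLex (a ∷ as) (a ∷ bs))
    tail rewrite ==-refl a | ≤ᵇ-refl a = lt

  <ₗ-¬head : ∀ {n a b} {as bs : Vec ℤ n} → b ℤ.< a → ¬ (a ∷ as) <ₗ (b ∷ bs)
  <ₗ-¬head {a = a} {b} b<a (lex lt) with a ≤ᵇ b in a≤b | a == b in a=b
  ... | true  | _     = ℤ.<⇒≱ b<a (ℤ.≤ᵇ⇒≤ (subst T (sym a≤b) _))
  ... | false | true  = ℤ.<⇒≢ b<a (sym (==⇒≡ (subst T (sym a=b) _)))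
  ... | false | false = lt

  <ₗ-irrefl : ∀ {n} {x : Vec ℤ n} → ¬ x <ₗ x
  <ₗ-irrefl {x = []}     (lex ())
  <ₗ-irrefl {x = a ∷ as} lt = <ₗ-irrefl (<ₗ-tail lt)

  <ₗ-∷⁻ : ∀ {n a b} {as bs : Vec ℤ n} → (a ∷ as) <ₗ (b ∷ bs) → a ℤ.< b ⊎ (a ≡ b × as <ₗ bs)
  <ₗ-∷⁻ {a = a} {b} lt with ℤ.<-cmp a b
  ... | tri< a<b _ _    = inj₁ a<b
  ... | tri≈ _ refl _   = inj₂ (refl , <ₗ-tail lt)
  ... | tri> _ _ b<a    = ⊥-elim (<ₗ-¬head b<a lt)

  <ₗ-trans : ∀ {n} {x y z : Vec ℤ n} → x <ₗ y → y <ₗ z → x <ₗ z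
  <ₗ-trans {x = []}     {[]}     {[]}     (lex ())
  <ₗ-trans {x = a ∷ as} {b ∷ bs} {c ∷ cs} x<y y<z with <ₗ-∷⁻ {a = a} {b} x<y | <ₗ-∷⁻ {a = b} {c} y<z
  ... | inj₁ a<b           | inj₁ b<c           = <ₗ-head (ℤ.<-trans a<b b<c)
  ... | inj₁ a<b           | inj₂ (refl , _)    = <ₗ-head a<b
  ... | inj₂ (refl , _)    | inj₁ b<c           = <ₗ-head b<c
  ... | inj₂ (refl , as<bs) | inj₂ (refl , bs<cs) = <ₗ-tail⁻ (<ₗ-trans as<bs bs<cs)

  strictlySorted⇒Linked : ∀ {l} → T (strictlySorted l) → Linked _<ₗ_ l
  strictlySorted⇒Linked {[]}         _ = []
  strictlySorted⇒Linked {x ∷ []}     _ = [-]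
  strictlySorted⇒Linked {x ∷ y ∷ zs} s =
    let (x<y , s′) = Equivalence.to T-∧ s in lex x<y ∷ strictlySorted⇒Linked s′

  Linked⇒strictlySorted : ∀ {l} → Linked _<ₗ_ l → T (strictlySorted l)
  Linked⇒strictlySorted []              = _
  Linked⇒strictlySorted [-]             = _
  Linked⇒strictlySorted (lex x<y ∷ lnk) = Equivalence.from T-∧ (x<y , Linked⇒strictlySorted lnk)

  strictlySorted⇒AllPairs : ∀ {l} → T (strictlySorted l) → AllPairs _<ₗ_ l
  strictlySorted⇒AllPairs = Linked⇒AllPairs <ₗ-trans ∘ strictlySorted⇒Linked

  AllPairs⇒strictlySorted : ∀ {l} → AllPairs _<ₗ_ l → T (strictlySorted l)
  AllPairs⇒strictlySorted = Linked⇒strictlySorted ∘ AllPairs⇒Linked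

open LexOrder

module Reflections where

  open import Data.Integer as ℤ using (ℤ; +_; -_; _+_; _*_; _-_; _/_)
  import Data.Integer.Properties as ℤ
  open import Data.Integer.Tactic.RingSolver using (solve-∀)
  open import Data.Vec using (zipWith)

  dot-comm : ∀ {n} (x y : Vec ℤ n) → dot x y ≡ dot y x
  dot-comm []       []       = refl
  dot-comm (x ∷ xs) (y ∷ ys) = cong₂ _+_ (ℤ.*-comm x y) (dot-comm xs ys)

  _-[_]·_ : ∀ {n} → Vec ℤ n → ℤ → Vec ℤ n → Vec ℤ n
  x -[ q ]· a = zipWith (λ xi ai → xi - q * ai) x a

  dot-shiftˡ : ∀ {n} q (x a y : Vec ℤ n) → dot (x -[ q ]· a) y ≡ dot x y - q * dot a y
  dot-shiftˡ q []       []       []       = nil q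
    where
    nil : ∀ q → + 0 ≡ + 0 - q * + 0
    nil = solve-∀
  dot-shiftˡ q (x ∷ xs) (a ∷ as) (y ∷ ys) rewrite dot-shiftˡ q xs as ys =
    step q x a y (dot xs ys) (dot as ys)
    where
    step : ∀ q x a y s t → (x - q * a) * y + (s - q * t) ≡ (x * y + s) - q * (a * y + t)
    step = solve-∀

  shift-shift : ∀ {n} q (x a : Vec ℤ n) → (x -[ q ]· a) -[ - q ]· a ≡ x
  shift-shift q []       []       = refl
  shift-shift q (x ∷ xs) (a ∷ as) = cong₂ _∷_ (step q x a) (shift-shift q xs as)
    where
    step : ∀ q x a → (x - q * a) - (- q) * a ≡ x
    step = solve-∀

  shift-zero : ∀ {n} (x a : Vec ℤ n) → x -[ + 0 ]· a ≡ x
  shift-zero []       []       = refl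
  shift-zero (x ∷ xs) (a ∷ as) = cong₂ _∷_ (step x a) (shift-zero xs as)
    where
    step : ∀ x a → x - + 0 * a ≡ x
    step = solve-∀

  -- In the doubled coordinates of Defs, ⟨x/2, a/2⟩ ∈ ℤ says that 4 divides dot x a, which makes the
  -- division in reflect exact.
  IntegralPairing : V8 → V8 → Set
  IntegralPairing x a = dot x a ≡ (dot x a / + 4) * + 4

  reflect-isometry : ∀ {a x y} → dot a a ≡ + 8 → IntegralPairing x a → IntegralPairing y a →
    dot (reflect a x) (reflect a y) ≡ dot x y
  reflect-isometry {a} {x} {y} aa xa ya = begin
    dot (x -[ p ]· a) y'                                 ≡⟨ dot-shiftˡ p x a y' ⟩
    dot x y' - p * dot a y'                              ≡⟨ cong₂ (λ u v → u - p * v) (dot-comm x y') (dot-comm a y') ⟩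
    dot y' x - p * dot y' a                              ≡⟨ cong₂ (λ u v → u - p * v) (dot-shiftˡ q y a x) (dot-shiftˡ q y a a) ⟩
    (dot y x - q * dot a x) - p * (dot y a - q * dot a a) ≡⟨ cong₂ (λ u v → (u - q * v) - p * (dot y a - q * dot a a)) (dot-comm y x) (trans (dot-comm a x) xa) ⟩
    (dot x y - q * (p * + 4)) - p * (dot y a - q * dot a a) ≡⟨ cong₂ (λ u v → (dot x y - q * (p * + 4)) - p * (u - q * v)) ya aa ⟩
    (dot x y - q * (p * + 4)) - p * (q * + 4 - q * + 8)  ≡⟨ cancel (dot x y) p q ⟩
    dot x y                                              ∎
    where
    open ≡-Reasoning
    p = dot x a / + 4
    q = dot y a / + 4
    y' = reflect a y
    cancel : ∀ d p q → (d - q * (p * + 4)) - p * (q * + 4 - q * + 8) ≡ d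
    cancel = solve-∀

  reflect-involutive : ∀ {a v} → dot a a ≡ + 8 → IntegralPairing v a → IntegralPairing (reflect a v) a →
    reflect a (reflect a v) ≡ v
  reflect-involutive {a} {v} aa va v'a = trans (cong (λ r → v' -[ r ]· a) q'≡-q) (shift-shift q v a)
    where
    q  = dot v a / + 4
    v' = reflect a v
    q'≡-q : dot v' a / + 4 ≡ - q
    q'≡-q = ℤ.*-cancelʳ-≡ _ _ (+ 4) (begin
      (dot v' a / + 4) * + 4 ≡⟨ sym v'a ⟩
      dot v' a               ≡⟨ dot-shiftˡ q v a a ⟩
      dot v a - q * dot a a  ≡⟨ cong₂ (λ u w → u - q * w) va aa ⟩
      q * + 4 - q * + 8      ≡⟨ halve q ⟩
      - q * + 4              ∎)
      where
      open ≡-Reasoning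
      halve : ∀ q → q * + 4 - q * + 8 ≡ - q * + 4
      halve = solve-∀

  reflect-orthogonal : ∀ {a p} → T (orth a p) → reflect a p ≡ p
  reflect-orthogonal {a} {p} ap =
    trans (cong (λ r → p -[ r / + 4 ]· a) (trans (dot-comm p a) (==⇒≡ ap))) (shift-zero p a)

open Reflections


-- The 240 roots, in doubled coordinates and in lexicographic order

module Roots where

  open import Data.Integer as ℤ using (ℤ; +_; -[1+_]; _*_; ∣_∣; _/_)
  open import Data.Integer.Properties using (+-injective)
  open import Data.List using (concatMap)
  open import Data.List.Membership.Propositional.Properties using (∈-concat⁺′)
  open import Data.Nat as ℕ using (ℕ; zero; suc; _∸_; _≤_; _≤ᵇ_)

  r0 r1 r2 r3 r4 r5 r6 r7 r8 r9 r10 r11 r12 r13 r14 r15 r16 r17 r18 r19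
    r20 r21 r22 r23 r24 r25 r26 r27 r28 r29 r30 r31 r32 r33 r34 r35 r36 r37 r38 r39
    r40 r41 r42 r43 r44 r45 r46 r47 r48 r49 r50 r51 r52 r53 r54 r55 r56 r57 r58 r59
    r60 r61 r62 r63 r64 r65 r66 r67 r68 r69 r70 r71 r72 r73 r74 r75 r76 r77 r78 r79
    r80 r81 r82 r83 r84 r85 r86 r87 r88 r89 r90 r91 r92 r93 r94 r95 r96 r97 r98 r99
    r100 r101 r102 r103 r104 r105 r106 r107 r108 r109 r110 r111 r112 r113 r114 r115 r116 r117 r118 r119
    r120 r121 r122 r123 r124 r125 r126 r127 r128 r129 r130 r131 r132 r133 r134 r135 r136 r137 r138 r139
    r140 r141 r142 r143 r144 r145 r146 r147 r148 r149 r150 r151 r152 r153 r154 r155 r156 r157 r158 r159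
    r160 r161 r162 r163 r164 r165 r166 r167 r168 r169 r170 r171 r172 r173 r174 r175 r176 r177 r178 r179
    r180 r181 r182 r183 r184 r185 r186 r187 r188 r189 r190 r191 r192 r193 r194 r195 r196 r197 r198 r199
    r200 r201 r202 r203 r204 r205 r206 r207 r208 r209 r210 r211 r212 r213 r214 r215 r216 r217 r218 r219
    r220 r221 r222 r223 r224 r225 r226 r227 r228 r229 r230 r231 r232 r233 r234 r235 r236 r237 r238 r239 : V8
  r0 = -[1+ 1 ] ∷ -[1+ 1 ] ∷ + 0 ∷ + 0 ∷ + 0 ∷ + 0 ∷ + 0 ∷ + 0 ∷ []
  r1 = -[1+ 1 ] ∷ + 0 ∷ -[1+ 1 ] ∷ + 0 ∷ + 0 ∷ + 0 ∷ + 0 ∷ + 0 ∷ []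
  r2 = -[1+ 1 ] ∷ + 0 ∷ + 0 ∷ -[1+ 1 ] ∷ + 0 ∷ + 0 ∷ + 0 ∷ + 0 ∷ []
  r3 = -[1+ 1 ] ∷ + 0 ∷ + 0 ∷ + 0 ∷ -[1+ 1 ] ∷ + 0 ∷ + 0 ∷ + 0 ∷ []
  r4 = -[1+ 1 ] ∷ + 0 ∷ + 0 ∷ + 0 ∷ + 0 ∷ -[1+ 1 ] ∷ + 0 ∷ + 0 ∷ []
  r5 = -[1+ 1 ] ∷ + 0 ∷ + 0 ∷ + 0 ∷ + 0 ∷ + 0 ∷ -[1+ 1 ] ∷ + 0 ∷ []
  r6 = -[1+ 1 ] ∷ + 0 ∷ + 0 ∷ + 0 ∷ + 0 ∷ + 0 ∷ + 0 ∷ -[1+ 1 ] ∷ []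
  r7 = -[1+ 1 ] ∷ + 0 ∷ + 0 ∷ + 0 ∷ + 0 ∷ + 0 ∷ + 0 ∷ + 2 ∷ []
  r8 = -[1+ 1 ] ∷ + 0 ∷ + 0 ∷ + 0 ∷ + 0 ∷ + 0 ∷ + 2 ∷ + 0 ∷ []
  r9 = -[1+ 1 ] ∷ + 0 ∷ + 0 ∷ + 0 ∷ + 0 ∷ + 2 ∷ + 0 ∷ + 0 ∷ []
  r10 = -[1+ 1 ] ∷ + 0 ∷ + 0 ∷ + 0 ∷ + 2 ∷ + 0 ∷ + 0 ∷ + 0 ∷ []
  r11 = -[1+ 1 ] ∷ + 0 ∷ + 0 ∷ + 2 ∷ + 0 ∷ + 0 ∷ + 0 ∷ + 0 ∷ []
  r12 = -[1+ 1 ] ∷ + 0 ∷ + 2 ∷ + 0 ∷ + 0 ∷ + 0 ∷ + 0 ∷ + 0 ∷ []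
  r13 = -[1+ 1 ] ∷ + 2 ∷ + 0 ∷ + 0 ∷ + 0 ∷ + 0 ∷ + 0 ∷ + 0 ∷ []
  r14 = -[1+ 0 ] ∷ -[1+ 0 ] ∷ -[1+ 0 ] ∷ -[1+ 0 ] ∷ -[1+ 0 ] ∷ -[1+ 0 ] ∷ -[1+ 0 ] ∷ -[1+ 0 ] ∷ []
  r15 = -[1+ 0 ] ∷ -[1+ 0 ] ∷ -[1+ 0 ] ∷ -[1+ 0 ] ∷ -[1+ 0 ] ∷ -[1+ 0 ] ∷ + 1 ∷ + 1 ∷ []
  r16 = -[1+ 0 ] ∷ -[1+ 0 ] ∷ -[1+ 0 ] ∷ -[1+ 0 ] ∷ -[1+ 0 ] ∷ + 1 ∷ -[1+ 0 ] ∷ + 1 ∷ []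
  r17 = -[1+ 0 ] ∷ -[1+ 0 ] ∷ -[1+ 0 ] ∷ -[1+ 0 ] ∷ -[1+ 0 ] ∷ + 1 ∷ + 1 ∷ -[1+ 0 ] ∷ []
  r18 = -[1+ 0 ] ∷ -[1+ 0 ] ∷ -[1+ 0 ] ∷ -[1+ 0 ] ∷ + 1 ∷ -[1+ 0 ] ∷ -[1+ 0 ] ∷ + 1 ∷ []
  r19 = -[1+ 0 ] ∷ -[1+ 0 ] ∷ -[1+ 0 ] ∷ -[1+ 0 ] ∷ + 1 ∷ -[1+ 0 ] ∷ + 1 ∷ -[1+ 0 ] ∷ []
  r20 = -[1+ 0 ] ∷ -[1+ 0 ] ∷ -[1+ 0 ] ∷ -[1+ 0 ] ∷ + 1 ∷ + 1 ∷ -[1+ 0 ] ∷ -[1+ 0 ] ∷ []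
  r21 = -[1+ 0 ] ∷ -[1+ 0 ] ∷ -[1+ 0 ] ∷ -[1+ 0 ] ∷ + 1 ∷ + 1 ∷ + 1 ∷ + 1 ∷ []
  r22 = -[1+ 0 ] ∷ -[1+ 0 ] ∷ -[1+ 0 ] ∷ + 1 ∷ -[1+ 0 ] ∷ -[1+ 0 ] ∷ -[1+ 0 ] ∷ + 1 ∷ []
  r23 = -[1+ 0 ] ∷ -[1+ 0 ] ∷ -[1+ 0 ] ∷ + 1 ∷ -[1+ 0 ] ∷ -[1+ 0 ] ∷ + 1 ∷ -[1+ 0 ] ∷ []
  r24 = -[1+ 0 ] ∷ -[1+ 0 ] ∷ -[1+ 0 ] ∷ + 1 ∷ -[1+ 0 ] ∷ + 1 ∷ -[1+ 0 ] ∷ -[1+ 0 ] ∷ []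
  r25 = -[1+ 0 ] ∷ -[1+ 0 ] ∷ -[1+ 0 ] ∷ + 1 ∷ -[1+ 0 ] ∷ + 1 ∷ + 1 ∷ + 1 ∷ []
  r26 = -[1+ 0 ] ∷ -[1+ 0 ] ∷ -[1+ 0 ] ∷ + 1 ∷ + 1 ∷ -[1+ 0 ] ∷ -[1+ 0 ] ∷ -[1+ 0 ] ∷ []
  r27 = -[1+ 0 ] ∷ -[1+ 0 ] ∷ -[1+ 0 ] ∷ + 1 ∷ + 1 ∷ -[1+ 0 ] ∷ + 1 ∷ + 1 ∷ []
  r28 = -[1+ 0 ] ∷ -[1+ 0 ] ∷ -[1+ 0 ] ∷ + 1 ∷ + 1 ∷ + 1 ∷ -[1+ 0 ] ∷ + 1 ∷ []
  r29 = -[1+ 0 ] ∷ -[1+ 0 ] ∷ -[1+ 0 ] ∷ + 1 ∷ + 1 ∷ + 1 ∷ + 1 ∷ -[1+ 0 ] ∷ []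
  r30 = -[1+ 0 ] ∷ -[1+ 0 ] ∷ + 1 ∷ -[1+ 0 ] ∷ -[1+ 0 ] ∷ -[1+ 0 ] ∷ -[1+ 0 ] ∷ + 1 ∷ []
  r31 = -[1+ 0 ] ∷ -[1+ 0 ] ∷ + 1 ∷ -[1+ 0 ] ∷ -[1+ 0 ] ∷ -[1+ 0 ] ∷ + 1 ∷ -[1+ 0 ] ∷ []
  r32 = -[1+ 0 ] ∷ -[1+ 0 ] ∷ + 1 ∷ -[1+ 0 ] ∷ -[1+ 0 ] ∷ + 1 ∷ -[1+ 0 ] ∷ -[1+ 0 ] ∷ []
  r33 = -[1+ 0 ] ∷ -[1+ 0 ] ∷ + 1 ∷ -[1+ 0 ] ∷ -[1+ 0 ] ∷ + 1 ∷ + 1 ∷ + 1 ∷ []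
  r34 = -[1+ 0 ] ∷ -[1+ 0 ] ∷ + 1 ∷ -[1+ 0 ] ∷ + 1 ∷ -[1+ 0 ] ∷ -[1+ 0 ] ∷ -[1+ 0 ] ∷ []
  r35 = -[1+ 0 ] ∷ -[1+ 0 ] ∷ + 1 ∷ -[1+ 0 ] ∷ + 1 ∷ -[1+ 0 ] ∷ + 1 ∷ + 1 ∷ []
  r36 = -[1+ 0 ] ∷ -[1+ 0 ] ∷ + 1 ∷ -[1+ 0 ] ∷ + 1 ∷ + 1 ∷ -[1+ 0 ] ∷ + 1 ∷ []
  r37 = -[1+ 0 ] ∷ -[1+ 0 ] ∷ + 1 ∷ -[1+ 0 ] ∷ + 1 ∷ + 1 ∷ + 1 ∷ -[1+ 0 ] ∷ []
  r38 = -[1+ 0 ] ∷ -[1+ 0 ] ∷ + 1 ∷ + 1 ∷ -[1+ 0 ] ∷ -[1+ 0 ] ∷ -[1+ 0 ] ∷ -[1+ 0 ] ∷ []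
  r39 = -[1+ 0 ] ∷ -[1+ 0 ] ∷ + 1 ∷ + 1 ∷ -[1+ 0 ] ∷ -[1+ 0 ] ∷ + 1 ∷ + 1 ∷ []
  r40 = -[1+ 0 ] ∷ -[1+ 0 ] ∷ + 1 ∷ + 1 ∷ -[1+ 0 ] ∷ + 1 ∷ -[1+ 0 ] ∷ + 1 ∷ []
  r41 = -[1+ 0 ] ∷ -[1+ 0 ] ∷ + 1 ∷ + 1 ∷ -[1+ 0 ] ∷ + 1 ∷ + 1 ∷ -[1+ 0 ] ∷ []
  r42 = -[1+ 0 ] ∷ -[1+ 0 ] ∷ + 1 ∷ + 1 ∷ + 1 ∷ -[1+ 0 ] ∷ -[1+ 0 ] ∷ + 1 ∷ []
  r43 = -[1+ 0 ] ∷ -[1+ 0 ] ∷ + 1 ∷ + 1 ∷ + 1 ∷ -[1+ 0 ] ∷ + 1 ∷ -[1+ 0 ] ∷ []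
  r44 = -[1+ 0 ] ∷ -[1+ 0 ] ∷ + 1 ∷ + 1 ∷ + 1 ∷ + 1 ∷ -[1+ 0 ] ∷ -[1+ 0 ] ∷ []
  r45 = -[1+ 0 ] ∷ -[1+ 0 ] ∷ + 1 ∷ + 1 ∷ + 1 ∷ + 1 ∷ + 1 ∷ + 1 ∷ []
  r46 = -[1+ 0 ] ∷ + 1 ∷ -[1+ 0 ] ∷ -[1+ 0 ] ∷ -[1+ 0 ] ∷ -[1+ 0 ] ∷ -[1+ 0 ] ∷ + 1 ∷ []
  r47 = -[1+ 0 ] ∷ + 1 ∷ -[1+ 0 ] ∷ -[1+ 0 ] ∷ -[1+ 0 ] ∷ -[1+ 0 ] ∷ + 1 ∷ -[1+ 0 ] ∷ []
  r48 = -[1+ 0 ] ∷ + 1 ∷ -[1+ 0 ] ∷ -[1+ 0 ] ∷ -[1+ 0 ] ∷ + 1 ∷ -[1+ 0 ] ∷ -[1+ 0 ] ∷ []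
  r49 = -[1+ 0 ] ∷ + 1 ∷ -[1+ 0 ] ∷ -[1+ 0 ] ∷ -[1+ 0 ] ∷ + 1 ∷ + 1 ∷ + 1 ∷ []
  r50 = -[1+ 0 ] ∷ + 1 ∷ -[1+ 0 ] ∷ -[1+ 0 ] ∷ + 1 ∷ -[1+ 0 ] ∷ -[1+ 0 ] ∷ -[1+ 0 ] ∷ []
  r51 = -[1+ 0 ] ∷ + 1 ∷ -[1+ 0 ] ∷ -[1+ 0 ] ∷ + 1 ∷ -[1+ 0 ] ∷ + 1 ∷ + 1 ∷ []
  r52 = -[1+ 0 ] ∷ + 1 ∷ -[1+ 0 ] ∷ -[1+ 0 ] ∷ + 1 ∷ + 1 ∷ -[1+ 0 ] ∷ + 1 ∷ []
  r53 = -[1+ 0 ] ∷ + 1 ∷ -[1+ 0 ] ∷ -[1+ 0 ] ∷ + 1 ∷ + 1 ∷ + 1 ∷ -[1+ 0 ] ∷ []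
  r54 = -[1+ 0 ] ∷ + 1 ∷ -[1+ 0 ] ∷ + 1 ∷ -[1+ 0 ] ∷ -[1+ 0 ] ∷ -[1+ 0 ] ∷ -[1+ 0 ] ∷ []
  r55 = -[1+ 0 ] ∷ + 1 ∷ -[1+ 0 ] ∷ + 1 ∷ -[1+ 0 ] ∷ -[1+ 0 ] ∷ + 1 ∷ + 1 ∷ []
  r56 = -[1+ 0 ] ∷ + 1 ∷ -[1+ 0 ] ∷ + 1 ∷ -[1+ 0 ] ∷ + 1 ∷ -[1+ 0 ] ∷ + 1 ∷ []
  r57 = -[1+ 0 ] ∷ + 1 ∷ -[1+ 0 ] ∷ + 1 ∷ -[1+ 0 ] ∷ + 1 ∷ + 1 ∷ -[1+ 0 ] ∷ []
  r58 = -[1+ 0 ] ∷ + 1 ∷ -[1+ 0 ] ∷ + 1 ∷ + 1 ∷ -[1+ 0 ] ∷ -[1+ 0 ] ∷ + 1 ∷ []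
  r59 = -[1+ 0 ] ∷ + 1 ∷ -[1+ 0 ] ∷ + 1 ∷ + 1 ∷ -[1+ 0 ] ∷ + 1 ∷ -[1+ 0 ] ∷ []
  r60 = -[1+ 0 ] ∷ + 1 ∷ -[1+ 0 ] ∷ + 1 ∷ + 1 ∷ + 1 ∷ -[1+ 0 ] ∷ -[1+ 0 ] ∷ []
  r61 = -[1+ 0 ] ∷ + 1 ∷ -[1+ 0 ] ∷ + 1 ∷ + 1 ∷ + 1 ∷ + 1 ∷ + 1 ∷ []
  r62 = -[1+ 0 ] ∷ + 1 ∷ + 1 ∷ -[1+ 0 ] ∷ -[1+ 0 ] ∷ -[1+ 0 ] ∷ -[1+ 0 ] ∷ -[1+ 0 ] ∷ []
  r63 = -[1+ 0 ] ∷ + 1 ∷ + 1 ∷ -[1+ 0 ] ∷ -[1+ 0 ] ∷ -[1+ 0 ] ∷ + 1 ∷ + 1 ∷ []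
  r64 = -[1+ 0 ] ∷ + 1 ∷ + 1 ∷ -[1+ 0 ] ∷ -[1+ 0 ] ∷ + 1 ∷ -[1+ 0 ] ∷ + 1 ∷ []
  r65 = -[1+ 0 ] ∷ + 1 ∷ + 1 ∷ -[1+ 0 ] ∷ -[1+ 0 ] ∷ + 1 ∷ + 1 ∷ -[1+ 0 ] ∷ []
  r66 = -[1+ 0 ] ∷ + 1 ∷ + 1 ∷ -[1+ 0 ] ∷ + 1 ∷ -[1+ 0 ] ∷ -[1+ 0 ] ∷ + 1 ∷ []
  r67 = -[1+ 0 ] ∷ + 1 ∷ + 1 ∷ -[1+ 0 ] ∷ + 1 ∷ -[1+ 0 ] ∷ + 1 ∷ -[1+ 0 ] ∷ []
  r68 = -[1+ 0 ] ∷ + 1 ∷ + 1 ∷ -[1+ 0 ] ∷ + 1 ∷ + 1 ∷ -[1+ 0 ] ∷ -[1+ 0 ] ∷ []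
  r69 = -[1+ 0 ] ∷ + 1 ∷ + 1 ∷ -[1+ 0 ] ∷ + 1 ∷ + 1 ∷ + 1 ∷ + 1 ∷ []
  r70 = -[1+ 0 ] ∷ + 1 ∷ + 1 ∷ + 1 ∷ -[1+ 0 ] ∷ -[1+ 0 ] ∷ -[1+ 0 ] ∷ + 1 ∷ []
  r71 = -[1+ 0 ] ∷ + 1 ∷ + 1 ∷ + 1 ∷ -[1+ 0 ] ∷ -[1+ 0 ] ∷ + 1 ∷ -[1+ 0 ] ∷ []
  r72 = -[1+ 0 ] ∷ + 1 ∷ + 1 ∷ + 1 ∷ -[1+ 0 ] ∷ + 1 ∷ -[1+ 0 ] ∷ -[1+ 0 ] ∷ []
  r73 = -[1+ 0 ] ∷ + 1 ∷ + 1 ∷ + 1 ∷ -[1+ 0 ] ∷ + 1 ∷ + 1 ∷ + 1 ∷ []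
  r74 = -[1+ 0 ] ∷ + 1 ∷ + 1 ∷ + 1 ∷ + 1 ∷ -[1+ 0 ] ∷ -[1+ 0 ] ∷ -[1+ 0 ] ∷ []
  r75 = -[1+ 0 ] ∷ + 1 ∷ + 1 ∷ + 1 ∷ + 1 ∷ -[1+ 0 ] ∷ + 1 ∷ + 1 ∷ []
  r76 = -[1+ 0 ] ∷ + 1 ∷ + 1 ∷ + 1 ∷ + 1 ∷ + 1 ∷ -[1+ 0 ] ∷ + 1 ∷ []
  r77 = -[1+ 0 ] ∷ + 1 ∷ + 1 ∷ + 1 ∷ + 1 ∷ + 1 ∷ + 1 ∷ -[1+ 0 ] ∷ []
  r78 = + 0 ∷ -[1+ 1 ] ∷ -[1+ 1 ] ∷ + 0 ∷ + 0 ∷ + 0 ∷ + 0 ∷ + 0 ∷ []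
  r79 = + 0 ∷ -[1+ 1 ] ∷ + 0 ∷ -[1+ 1 ] ∷ + 0 ∷ + 0 ∷ + 0 ∷ + 0 ∷ []
  r80 = + 0 ∷ -[1+ 1 ] ∷ + 0 ∷ + 0 ∷ -[1+ 1 ] ∷ + 0 ∷ + 0 ∷ + 0 ∷ []
  r81 = + 0 ∷ -[1+ 1 ] ∷ + 0 ∷ + 0 ∷ + 0 ∷ -[1+ 1 ] ∷ + 0 ∷ + 0 ∷ []
  r82 = + 0 ∷ -[1+ 1 ] ∷ + 0 ∷ + 0 ∷ + 0 ∷ + 0 ∷ -[1+ 1 ] ∷ + 0 ∷ []
  r83 = + 0 ∷ -[1+ 1 ] ∷ + 0 ∷ + 0 ∷ + 0 ∷ + 0 ∷ + 0 ∷ -[1+ 1 ] ∷ []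
  r84 = + 0 ∷ -[1+ 1 ] ∷ + 0 ∷ + 0 ∷ + 0 ∷ + 0 ∷ + 0 ∷ + 2 ∷ []
  r85 = + 0 ∷ -[1+ 1 ] ∷ + 0 ∷ + 0 ∷ + 0 ∷ + 0 ∷ + 2 ∷ + 0 ∷ []
  r86 = + 0 ∷ -[1+ 1 ] ∷ + 0 ∷ + 0 ∷ + 0 ∷ + 2 ∷ + 0 ∷ + 0 ∷ []
  r87 = + 0 ∷ -[1+ 1 ] ∷ + 0 ∷ + 0 ∷ + 2 ∷ + 0 ∷ + 0 ∷ + 0 ∷ []
  r88 = + 0 ∷ -[1+ 1 ] ∷ + 0 ∷ + 2 ∷ + 0 ∷ + 0 ∷ + 0 ∷ + 0 ∷ []
  r89 = + 0 ∷ -[1+ 1 ] ∷ + 2 ∷ + 0 ∷ + 0 ∷ + 0 ∷ + 0 ∷ + 0 ∷ []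
  r90 = + 0 ∷ + 0 ∷ -[1+ 1 ] ∷ -[1+ 1 ] ∷ + 0 ∷ + 0 ∷ + 0 ∷ + 0 ∷ []
  r91 = + 0 ∷ + 0 ∷ -[1+ 1 ] ∷ + 0 ∷ -[1+ 1 ] ∷ + 0 ∷ + 0 ∷ + 0 ∷ []
  r92 = + 0 ∷ + 0 ∷ -[1+ 1 ] ∷ + 0 ∷ + 0 ∷ -[1+ 1 ] ∷ + 0 ∷ + 0 ∷ []
  r93 = + 0 ∷ + 0 ∷ -[1+ 1 ] ∷ + 0 ∷ + 0 ∷ + 0 ∷ -[1+ 1 ] ∷ + 0 ∷ []
  r94 = + 0 ∷ + 0 ∷ -[1+ 1 ] ∷ + 0 ∷ + 0 ∷ + 0 ∷ + 0 ∷ -[1+ 1 ] ∷ []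
  r95 = + 0 ∷ + 0 ∷ -[1+ 1 ] ∷ + 0 ∷ + 0 ∷ + 0 ∷ + 0 ∷ + 2 ∷ []
  r96 = + 0 ∷ + 0 ∷ -[1+ 1 ] ∷ + 0 ∷ + 0 ∷ + 0 ∷ + 2 ∷ + 0 ∷ []
  r97 = + 0 ∷ + 0 ∷ -[1+ 1 ] ∷ + 0 ∷ + 0 ∷ + 2 ∷ + 0 ∷ + 0 ∷ []
  r98 = + 0 ∷ + 0 ∷ -[1+ 1 ] ∷ + 0 ∷ + 2 ∷ + 0 ∷ + 0 ∷ + 0 ∷ []
  r99 = + 0 ∷ + 0 ∷ -[1+ 1 ] ∷ + 2 ∷ + 0 ∷ + 0 ∷ + 0 ∷ + 0 ∷ []
  r100 = + 0 ∷ + 0 ∷ + 0 ∷ -[1+ 1 ] ∷ -[1+ 1 ] ∷ + 0 ∷ + 0 ∷ + 0 ∷ []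
  r101 = + 0 ∷ + 0 ∷ + 0 ∷ -[1+ 1 ] ∷ + 0 ∷ -[1+ 1 ] ∷ + 0 ∷ + 0 ∷ []
  r102 = + 0 ∷ + 0 ∷ + 0 ∷ -[1+ 1 ] ∷ + 0 ∷ + 0 ∷ -[1+ 1 ] ∷ + 0 ∷ []
  r103 = + 0 ∷ + 0 ∷ + 0 ∷ -[1+ 1 ] ∷ + 0 ∷ + 0 ∷ + 0 ∷ -[1+ 1 ] ∷ []
  r104 = + 0 ∷ + 0 ∷ + 0 ∷ -[1+ 1 ] ∷ + 0 ∷ + 0 ∷ + 0 ∷ + 2 ∷ []
  r105 = + 0 ∷ + 0 ∷ + 0 ∷ -[1+ 1 ] ∷ + 0 ∷ + 0 ∷ + 2 ∷ + 0 ∷ []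
  r106 = + 0 ∷ + 0 ∷ + 0 ∷ -[1+ 1 ] ∷ + 0 ∷ + 2 ∷ + 0 ∷ + 0 ∷ []
  r107 = + 0 ∷ + 0 ∷ + 0 ∷ -[1+ 1 ] ∷ + 2 ∷ + 0 ∷ + 0 ∷ + 0 ∷ []
  r108 = + 0 ∷ + 0 ∷ + 0 ∷ + 0 ∷ -[1+ 1 ] ∷ -[1+ 1 ] ∷ + 0 ∷ + 0 ∷ []
  r109 = + 0 ∷ + 0 ∷ + 0 ∷ + 0 ∷ -[1+ 1 ] ∷ + 0 ∷ -[1+ 1 ] ∷ + 0 ∷ []
  r110 = + 0 ∷ + 0 ∷ + 0 ∷ + 0 ∷ -[1+ 1 ] ∷ + 0 ∷ + 0 ∷ -[1+ 1 ] ∷ []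
  r111 = + 0 ∷ + 0 ∷ + 0 ∷ + 0 ∷ -[1+ 1 ] ∷ + 0 ∷ + 0 ∷ + 2 ∷ []
  r112 = + 0 ∷ + 0 ∷ + 0 ∷ + 0 ∷ -[1+ 1 ] ∷ + 0 ∷ + 2 ∷ + 0 ∷ []
  r113 = + 0 ∷ + 0 ∷ + 0 ∷ + 0 ∷ -[1+ 1 ] ∷ + 2 ∷ + 0 ∷ + 0 ∷ []
  r114 = + 0 ∷ + 0 ∷ + 0 ∷ + 0 ∷ + 0 ∷ -[1+ 1 ] ∷ -[1+ 1 ] ∷ + 0 ∷ []
  r115 = + 0 ∷ + 0 ∷ + 0 ∷ + 0 ∷ + 0 ∷ -[1+ 1 ] ∷ + 0 ∷ -[1+ 1 ] ∷ []
  r116 = + 0 ∷ + 0 ∷ + 0 ∷ + 0 ∷ + 0 ∷ -[1+ 1 ] ∷ + 0 ∷ + 2 ∷ []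
  r117 = + 0 ∷ + 0 ∷ + 0 ∷ + 0 ∷ + 0 ∷ -[1+ 1 ] ∷ + 2 ∷ + 0 ∷ []
  r118 = + 0 ∷ + 0 ∷ + 0 ∷ + 0 ∷ + 0 ∷ + 0 ∷ -[1+ 1 ] ∷ -[1+ 1 ] ∷ []
  r119 = + 0 ∷ + 0 ∷ + 0 ∷ + 0 ∷ + 0 ∷ + 0 ∷ -[1+ 1 ] ∷ + 2 ∷ []
  r120 = + 0 ∷ + 0 ∷ + 0 ∷ + 0 ∷ + 0 ∷ + 0 ∷ + 2 ∷ -[1+ 1 ] ∷ []
  r121 = + 0 ∷ + 0 ∷ + 0 ∷ + 0 ∷ + 0 ∷ + 0 ∷ + 2 ∷ + 2 ∷ []
  r122 = + 0 ∷ + 0 ∷ + 0 ∷ + 0 ∷ + 0 ∷ + 2 ∷ -[1+ 1 ] ∷ + 0 ∷ []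
  r123 = + 0 ∷ + 0 ∷ + 0 ∷ + 0 ∷ + 0 ∷ + 2 ∷ + 0 ∷ -[1+ 1 ] ∷ []
  r124 = + 0 ∷ + 0 ∷ + 0 ∷ + 0 ∷ + 0 ∷ + 2 ∷ + 0 ∷ + 2 ∷ []
  r125 = + 0 ∷ + 0 ∷ + 0 ∷ + 0 ∷ + 0 ∷ + 2 ∷ + 2 ∷ + 0 ∷ []
  r126 = + 0 ∷ + 0 ∷ + 0 ∷ + 0 ∷ + 2 ∷ -[1+ 1 ] ∷ + 0 ∷ + 0 ∷ []
  r127 = + 0 ∷ + 0 ∷ + 0 ∷ + 0 ∷ + 2 ∷ + 0 ∷ -[1+ 1 ] ∷ + 0 ∷ []
  r128 = + 0 ∷ + 0 ∷ + 0 ∷ + 0 ∷ + 2 ∷ + 0 ∷ + 0 ∷ -[1+ 1 ] ∷ []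
  r129 = + 0 ∷ + 0 ∷ + 0 ∷ + 0 ∷ + 2 ∷ + 0 ∷ + 0 ∷ + 2 ∷ []
  r130 = + 0 ∷ + 0 ∷ + 0 ∷ + 0 ∷ + 2 ∷ + 0 ∷ + 2 ∷ + 0 ∷ []
  r131 = + 0 ∷ + 0 ∷ + 0 ∷ + 0 ∷ + 2 ∷ + 2 ∷ + 0 ∷ + 0 ∷ []
  r132 = + 0 ∷ + 0 ∷ + 0 ∷ + 2 ∷ -[1+ 1 ] ∷ + 0 ∷ + 0 ∷ + 0 ∷ []
  r133 = + 0 ∷ + 0 ∷ + 0 ∷ + 2 ∷ + 0 ∷ -[1+ 1 ] ∷ + 0 ∷ + 0 ∷ []
  r134 = + 0 ∷ + 0 ∷ + 0 ∷ + 2 ∷ + 0 ∷ + 0 ∷ -[1+ 1 ] ∷ + 0 ∷ []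
  r135 = + 0 ∷ + 0 ∷ + 0 ∷ + 2 ∷ + 0 ∷ + 0 ∷ + 0 ∷ -[1+ 1 ] ∷ []
  r136 = + 0 ∷ + 0 ∷ + 0 ∷ + 2 ∷ + 0 ∷ + 0 ∷ + 0 ∷ + 2 ∷ []
  r137 = + 0 ∷ + 0 ∷ + 0 ∷ + 2 ∷ + 0 ∷ + 0 ∷ + 2 ∷ + 0 ∷ []
  r138 = + 0 ∷ + 0 ∷ + 0 ∷ + 2 ∷ + 0 ∷ + 2 ∷ + 0 ∷ + 0 ∷ []
  r139 = + 0 ∷ + 0 ∷ + 0 ∷ + 2 ∷ + 2 ∷ + 0 ∷ + 0 ∷ + 0 ∷ []
  r140 = + 0 ∷ + 0 ∷ + 2 ∷ -[1+ 1 ] ∷ + 0 ∷ + 0 ∷ + 0 ∷ + 0 ∷ []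
  r141 = + 0 ∷ + 0 ∷ + 2 ∷ + 0 ∷ -[1+ 1 ] ∷ + 0 ∷ + 0 ∷ + 0 ∷ []
  r142 = + 0 ∷ + 0 ∷ + 2 ∷ + 0 ∷ + 0 ∷ -[1+ 1 ] ∷ + 0 ∷ + 0 ∷ []
  r143 = + 0 ∷ + 0 ∷ + 2 ∷ + 0 ∷ + 0 ∷ + 0 ∷ -[1+ 1 ] ∷ + 0 ∷ []
  r144 = + 0 ∷ + 0 ∷ + 2 ∷ + 0 ∷ + 0 ∷ + 0 ∷ + 0 ∷ -[1+ 1 ] ∷ []
  r145 = + 0 ∷ + 0 ∷ + 2 ∷ + 0 ∷ + 0 ∷ + 0 ∷ + 0 ∷ + 2 ∷ []
  r146 = + 0 ∷ + 0 ∷ + 2 ∷ + 0 ∷ + 0 ∷ + 0 ∷ + 2 ∷ + 0 ∷ []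
  r147 = + 0 ∷ + 0 ∷ + 2 ∷ + 0 ∷ + 0 ∷ + 2 ∷ + 0 ∷ + 0 ∷ []
  r148 = + 0 ∷ + 0 ∷ + 2 ∷ + 0 ∷ + 2 ∷ + 0 ∷ + 0 ∷ + 0 ∷ []
  r149 = + 0 ∷ + 0 ∷ + 2 ∷ + 2 ∷ + 0 ∷ + 0 ∷ + 0 ∷ + 0 ∷ []
  r150 = + 0 ∷ + 2 ∷ -[1+ 1 ] ∷ + 0 ∷ + 0 ∷ + 0 ∷ + 0 ∷ + 0 ∷ []
  r151 = + 0 ∷ + 2 ∷ + 0 ∷ -[1+ 1 ] ∷ + 0 ∷ + 0 ∷ + 0 ∷ + 0 ∷ []
  r152 = + 0 ∷ + 2 ∷ + 0 ∷ + 0 ∷ -[1+ 1 ] ∷ + 0 ∷ + 0 ∷ + 0 ∷ []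
  r153 = + 0 ∷ + 2 ∷ + 0 ∷ + 0 ∷ + 0 ∷ -[1+ 1 ] ∷ + 0 ∷ + 0 ∷ []
  r154 = + 0 ∷ + 2 ∷ + 0 ∷ + 0 ∷ + 0 ∷ + 0 ∷ -[1+ 1 ] ∷ + 0 ∷ []
  r155 = + 0 ∷ + 2 ∷ + 0 ∷ + 0 ∷ + 0 ∷ + 0 ∷ + 0 ∷ -[1+ 1 ] ∷ []
  r156 = + 0 ∷ + 2 ∷ + 0 ∷ + 0 ∷ + 0 ∷ + 0 ∷ + 0 ∷ + 2 ∷ []
  r157 = + 0 ∷ + 2 ∷ + 0 ∷ + 0 ∷ + 0 ∷ + 0 ∷ + 2 ∷ + 0 ∷ []
  r158 = + 0 ∷ + 2 ∷ + 0 ∷ + 0 ∷ + 0 ∷ + 2 ∷ + 0 ∷ + 0 ∷ []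
  r159 = + 0 ∷ + 2 ∷ + 0 ∷ + 0 ∷ + 2 ∷ + 0 ∷ + 0 ∷ + 0 ∷ []
  r160 = + 0 ∷ + 2 ∷ + 0 ∷ + 2 ∷ + 0 ∷ + 0 ∷ + 0 ∷ + 0 ∷ []
  r161 = + 0 ∷ + 2 ∷ + 2 ∷ + 0 ∷ + 0 ∷ + 0 ∷ + 0 ∷ + 0 ∷ []
  r162 = + 1 ∷ -[1+ 0 ] ∷ -[1+ 0 ] ∷ -[1+ 0 ] ∷ -[1+ 0 ] ∷ -[1+ 0 ] ∷ -[1+ 0 ] ∷ + 1 ∷ []
  r163 = + 1 ∷ -[1+ 0 ] ∷ -[1+ 0 ] ∷ -[1+ 0 ] ∷ -[1+ 0 ] ∷ -[1+ 0 ] ∷ + 1 ∷ -[1+ 0 ] ∷ []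
  r164 = + 1 ∷ -[1+ 0 ] ∷ -[1+ 0 ] ∷ -[1+ 0 ] ∷ -[1+ 0 ] ∷ + 1 ∷ -[1+ 0 ] ∷ -[1+ 0 ] ∷ []
  r165 = + 1 ∷ -[1+ 0 ] ∷ -[1+ 0 ] ∷ -[1+ 0 ] ∷ -[1+ 0 ] ∷ + 1 ∷ + 1 ∷ + 1 ∷ []
  r166 = + 1 ∷ -[1+ 0 ] ∷ -[1+ 0 ] ∷ -[1+ 0 ] ∷ + 1 ∷ -[1+ 0 ] ∷ -[1+ 0 ] ∷ -[1+ 0 ] ∷ []
  r167 = + 1 ∷ -[1+ 0 ] ∷ -[1+ 0 ] ∷ -[1+ 0 ] ∷ + 1 ∷ -[1+ 0 ] ∷ + 1 ∷ + 1 ∷ []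
  r168 = + 1 ∷ -[1+ 0 ] ∷ -[1+ 0 ] ∷ -[1+ 0 ] ∷ + 1 ∷ + 1 ∷ -[1+ 0 ] ∷ + 1 ∷ []
  r169 = + 1 ∷ -[1+ 0 ] ∷ -[1+ 0 ] ∷ -[1+ 0 ] ∷ + 1 ∷ + 1 ∷ + 1 ∷ -[1+ 0 ] ∷ []
  r170 = + 1 ∷ -[1+ 0 ] ∷ -[1+ 0 ] ∷ + 1 ∷ -[1+ 0 ] ∷ -[1+ 0 ] ∷ -[1+ 0 ] ∷ -[1+ 0 ] ∷ []
  r171 = + 1 ∷ -[1+ 0 ] ∷ -[1+ 0 ] ∷ + 1 ∷ -[1+ 0 ] ∷ -[1+ 0 ] ∷ + 1 ∷ + 1 ∷ []
  r172 = + 1 ∷ -[1+ 0 ] ∷ -[1+ 0 ] ∷ + 1 ∷ -[1+ 0 ] ∷ + 1 ∷ -[1+ 0 ] ∷ + 1 ∷ []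
  r173 = + 1 ∷ -[1+ 0 ] ∷ -[1+ 0 ] ∷ + 1 ∷ -[1+ 0 ] ∷ + 1 ∷ + 1 ∷ -[1+ 0 ] ∷ []
  r174 = + 1 ∷ -[1+ 0 ] ∷ -[1+ 0 ] ∷ + 1 ∷ + 1 ∷ -[1+ 0 ] ∷ -[1+ 0 ] ∷ + 1 ∷ []
  r175 = + 1 ∷ -[1+ 0 ] ∷ -[1+ 0 ] ∷ + 1 ∷ + 1 ∷ -[1+ 0 ] ∷ + 1 ∷ -[1+ 0 ] ∷ []
  r176 = + 1 ∷ -[1+ 0 ] ∷ -[1+ 0 ] ∷ + 1 ∷ + 1 ∷ + 1 ∷ -[1+ 0 ] ∷ -[1+ 0 ] ∷ []
  r177 = + 1 ∷ -[1+ 0 ] ∷ -[1+ 0 ] ∷ + 1 ∷ + 1 ∷ + 1 ∷ + 1 ∷ + 1 ∷ []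
  r178 = + 1 ∷ -[1+ 0 ] ∷ + 1 ∷ -[1+ 0 ] ∷ -[1+ 0 ] ∷ -[1+ 0 ] ∷ -[1+ 0 ] ∷ -[1+ 0 ] ∷ []
  r179 = + 1 ∷ -[1+ 0 ] ∷ + 1 ∷ -[1+ 0 ] ∷ -[1+ 0 ] ∷ -[1+ 0 ] ∷ + 1 ∷ + 1 ∷ []
  r180 = + 1 ∷ -[1+ 0 ] ∷ + 1 ∷ -[1+ 0 ] ∷ -[1+ 0 ] ∷ + 1 ∷ -[1+ 0 ] ∷ + 1 ∷ []
  r181 = + 1 ∷ -[1+ 0 ] ∷ + 1 ∷ -[1+ 0 ] ∷ -[1+ 0 ] ∷ + 1 ∷ + 1 ∷ -[1+ 0 ] ∷ []
  r182 = + 1 ∷ -[1+ 0 ] ∷ + 1 ∷ -[1+ 0 ] ∷ + 1 ∷ -[1+ 0 ] ∷ -[1+ 0 ] ∷ + 1 ∷ []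
  r183 = + 1 ∷ -[1+ 0 ] ∷ + 1 ∷ -[1+ 0 ] ∷ + 1 ∷ -[1+ 0 ] ∷ + 1 ∷ -[1+ 0 ] ∷ []
  r184 = + 1 ∷ -[1+ 0 ] ∷ + 1 ∷ -[1+ 0 ] ∷ + 1 ∷ + 1 ∷ -[1+ 0 ] ∷ -[1+ 0 ] ∷ []
  r185 = + 1 ∷ -[1+ 0 ] ∷ + 1 ∷ -[1+ 0 ] ∷ + 1 ∷ + 1 ∷ + 1 ∷ + 1 ∷ []
  r186 = + 1 ∷ -[1+ 0 ] ∷ + 1 ∷ + 1 ∷ -[1+ 0 ] ∷ -[1+ 0 ] ∷ -[1+ 0 ] ∷ + 1 ∷ []
  r187 = + 1 ∷ -[1+ 0 ] ∷ + 1 ∷ + 1 ∷ -[1+ 0 ] ∷ -[1+ 0 ] ∷ + 1 ∷ -[1+ 0 ] ∷ []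
  r188 = + 1 ∷ -[1+ 0 ] ∷ + 1 ∷ + 1 ∷ -[1+ 0 ] ∷ + 1 ∷ -[1+ 0 ] ∷ -[1+ 0 ] ∷ []
  r189 = + 1 ∷ -[1+ 0 ] ∷ + 1 ∷ + 1 ∷ -[1+ 0 ] ∷ + 1 ∷ + 1 ∷ + 1 ∷ []
  r190 = + 1 ∷ -[1+ 0 ] ∷ + 1 ∷ + 1 ∷ + 1 ∷ -[1+ 0 ] ∷ -[1+ 0 ] ∷ -[1+ 0 ] ∷ []
  r191 = + 1 ∷ -[1+ 0 ] ∷ + 1 ∷ + 1 ∷ + 1 ∷ -[1+ 0 ] ∷ + 1 ∷ + 1 ∷ []
  r192 = + 1 ∷ -[1+ 0 ] ∷ + 1 ∷ + 1 ∷ + 1 ∷ + 1 ∷ -[1+ 0 ] ∷ + 1 ∷ []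
  r193 = + 1 ∷ -[1+ 0 ] ∷ + 1 ∷ + 1 ∷ + 1 ∷ + 1 ∷ + 1 ∷ -[1+ 0 ] ∷ []
  r194 = + 1 ∷ + 1 ∷ -[1+ 0 ] ∷ -[1+ 0 ] ∷ -[1+ 0 ] ∷ -[1+ 0 ] ∷ -[1+ 0 ] ∷ -[1+ 0 ] ∷ []
  r195 = + 1 ∷ + 1 ∷ -[1+ 0 ] ∷ -[1+ 0 ] ∷ -[1+ 0 ] ∷ -[1+ 0 ] ∷ + 1 ∷ + 1 ∷ []
  r196 = + 1 ∷ + 1 ∷ -[1+ 0 ] ∷ -[1+ 0 ] ∷ -[1+ 0 ] ∷ + 1 ∷ -[1+ 0 ] ∷ + 1 ∷ []
  r197 = + 1 ∷ + 1 ∷ -[1+ 0 ] ∷ -[1+ 0 ] ∷ -[1+ 0 ] ∷ + 1 ∷ + 1 ∷ -[1+ 0 ] ∷ []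
  r198 = + 1 ∷ + 1 ∷ -[1+ 0 ] ∷ -[1+ 0 ] ∷ + 1 ∷ -[1+ 0 ] ∷ -[1+ 0 ] ∷ + 1 ∷ []
  r199 = + 1 ∷ + 1 ∷ -[1+ 0 ] ∷ -[1+ 0 ] ∷ + 1 ∷ -[1+ 0 ] ∷ + 1 ∷ -[1+ 0 ] ∷ []
  r200 = + 1 ∷ + 1 ∷ -[1+ 0 ] ∷ -[1+ 0 ] ∷ + 1 ∷ + 1 ∷ -[1+ 0 ] ∷ -[1+ 0 ] ∷ []
  r201 = + 1 ∷ + 1 ∷ -[1+ 0 ] ∷ -[1+ 0 ] ∷ + 1 ∷ + 1 ∷ + 1 ∷ + 1 ∷ []
  r202 = + 1 ∷ + 1 ∷ -[1+ 0 ] ∷ + 1 ∷ -[1+ 0 ] ∷ -[1+ 0 ] ∷ -[1+ 0 ] ∷ + 1 ∷ []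
  r203 = + 1 ∷ + 1 ∷ -[1+ 0 ] ∷ + 1 ∷ -[1+ 0 ] ∷ -[1+ 0 ] ∷ + 1 ∷ -[1+ 0 ] ∷ []
  r204 = + 1 ∷ + 1 ∷ -[1+ 0 ] ∷ + 1 ∷ -[1+ 0 ] ∷ + 1 ∷ -[1+ 0 ] ∷ -[1+ 0 ] ∷ []
  r205 = + 1 ∷ + 1 ∷ -[1+ 0 ] ∷ + 1 ∷ -[1+ 0 ] ∷ + 1 ∷ + 1 ∷ + 1 ∷ []
  r206 = + 1 ∷ + 1 ∷ -[1+ 0 ] ∷ + 1 ∷ + 1 ∷ -[1+ 0 ] ∷ -[1+ 0 ] ∷ -[1+ 0 ] ∷ []
  r207 = + 1 ∷ + 1 ∷ -[1+ 0 ] ∷ + 1 ∷ + 1 ∷ -[1+ 0 ] ∷ + 1 ∷ + 1 ∷ []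
  r208 = + 1 ∷ + 1 ∷ -[1+ 0 ] ∷ + 1 ∷ + 1 ∷ + 1 ∷ -[1+ 0 ] ∷ + 1 ∷ []
  r209 = + 1 ∷ + 1 ∷ -[1+ 0 ] ∷ + 1 ∷ + 1 ∷ + 1 ∷ + 1 ∷ -[1+ 0 ] ∷ []
  r210 = + 1 ∷ + 1 ∷ + 1 ∷ -[1+ 0 ] ∷ -[1+ 0 ] ∷ -[1+ 0 ] ∷ -[1+ 0 ] ∷ + 1 ∷ []
  r211 = + 1 ∷ + 1 ∷ + 1 ∷ -[1+ 0 ] ∷ -[1+ 0 ] ∷ -[1+ 0 ] ∷ + 1 ∷ -[1+ 0 ] ∷ []
  r212 = + 1 ∷ + 1 ∷ + 1 ∷ -[1+ 0 ] ∷ -[1+ 0 ] ∷ + 1 ∷ -[1+ 0 ] ∷ -[1+ 0 ] ∷ []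
  r213 = + 1 ∷ + 1 ∷ + 1 ∷ -[1+ 0 ] ∷ -[1+ 0 ] ∷ + 1 ∷ + 1 ∷ + 1 ∷ []
  r214 = + 1 ∷ + 1 ∷ + 1 ∷ -[1+ 0 ] ∷ + 1 ∷ -[1+ 0 ] ∷ -[1+ 0 ] ∷ -[1+ 0 ] ∷ []
  r215 = + 1 ∷ + 1 ∷ + 1 ∷ -[1+ 0 ] ∷ + 1 ∷ -[1+ 0 ] ∷ + 1 ∷ + 1 ∷ []
  r216 = + 1 ∷ + 1 ∷ + 1 ∷ -[1+ 0 ] ∷ + 1 ∷ + 1 ∷ -[1+ 0 ] ∷ + 1 ∷ []
  r217 = + 1 ∷ + 1 ∷ + 1 ∷ -[1+ 0 ] ∷ + 1 ∷ + 1 ∷ + 1 ∷ -[1+ 0 ] ∷ []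
  r218 = + 1 ∷ + 1 ∷ + 1 ∷ + 1 ∷ -[1+ 0 ] ∷ -[1+ 0 ] ∷ -[1+ 0 ] ∷ -[1+ 0 ] ∷ []
  r219 = + 1 ∷ + 1 ∷ + 1 ∷ + 1 ∷ -[1+ 0 ] ∷ -[1+ 0 ] ∷ + 1 ∷ + 1 ∷ []
  r220 = + 1 ∷ + 1 ∷ + 1 ∷ + 1 ∷ -[1+ 0 ] ∷ + 1 ∷ -[1+ 0 ] ∷ + 1 ∷ []
  r221 = + 1 ∷ + 1 ∷ + 1 ∷ + 1 ∷ -[1+ 0 ] ∷ + 1 ∷ + 1 ∷ -[1+ 0 ] ∷ []
  r222 = + 1 ∷ + 1 ∷ + 1 ∷ + 1 ∷ + 1 ∷ -[1+ 0 ] ∷ -[1+ 0 ] ∷ + 1 ∷ []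
  r223 = + 1 ∷ + 1 ∷ + 1 ∷ + 1 ∷ + 1 ∷ -[1+ 0 ] ∷ + 1 ∷ -[1+ 0 ] ∷ []
  r224 = + 1 ∷ + 1 ∷ + 1 ∷ + 1 ∷ + 1 ∷ + 1 ∷ -[1+ 0 ] ∷ -[1+ 0 ] ∷ []
  r225 = + 1 ∷ + 1 ∷ + 1 ∷ + 1 ∷ + 1 ∷ + 1 ∷ + 1 ∷ + 1 ∷ []
  r226 = + 2 ∷ -[1+ 1 ] ∷ + 0 ∷ + 0 ∷ + 0 ∷ + 0 ∷ + 0 ∷ + 0 ∷ []
  r227 = + 2 ∷ + 0 ∷ -[1+ 1 ] ∷ + 0 ∷ + 0 ∷ + 0 ∷ + 0 ∷ + 0 ∷ []
  r228 = + 2 ∷ + 0 ∷ + 0 ∷ -[1+ 1 ] ∷ + 0 ∷ + 0 ∷ + 0 ∷ + 0 ∷ []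
  r229 = + 2 ∷ + 0 ∷ + 0 ∷ + 0 ∷ -[1+ 1 ] ∷ + 0 ∷ + 0 ∷ + 0 ∷ []
  r230 = + 2 ∷ + 0 ∷ + 0 ∷ + 0 ∷ + 0 ∷ -[1+ 1 ] ∷ + 0 ∷ + 0 ∷ []
  r231 = + 2 ∷ + 0 ∷ + 0 ∷ + 0 ∷ + 0 ∷ + 0 ∷ -[1+ 1 ] ∷ + 0 ∷ []
  r232 = + 2 ∷ + 0 ∷ + 0 ∷ + 0 ∷ + 0 ∷ + 0 ∷ + 0 ∷ -[1+ 1 ] ∷ []
  r233 = + 2 ∷ + 0 ∷ + 0 ∷ + 0 ∷ + 0 ∷ + 0 ∷ + 0 ∷ + 2 ∷ []
  r234 = + 2 ∷ + 0 ∷ + 0 ∷ + 0 ∷ + 0 ∷ + 0 ∷ + 2 ∷ + 0 ∷ []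
  r235 = + 2 ∷ + 0 ∷ + 0 ∷ + 0 ∷ + 0 ∷ + 2 ∷ + 0 ∷ + 0 ∷ []
  r236 = + 2 ∷ + 0 ∷ + 0 ∷ + 0 ∷ + 2 ∷ + 0 ∷ + 0 ∷ + 0 ∷ []
  r237 = + 2 ∷ + 0 ∷ + 0 ∷ + 2 ∷ + 0 ∷ + 0 ∷ + 0 ∷ + 0 ∷ []
  r238 = + 2 ∷ + 0 ∷ + 2 ∷ + 0 ∷ + 0 ∷ + 0 ∷ + 0 ∷ + 0 ∷ []
  r239 = + 2 ∷ + 2 ∷ + 0 ∷ + 0 ∷ + 0 ∷ + 0 ∷ + 0 ∷ + 0 ∷ []

  roots : List V8
  roots = r0 ∷ r1 ∷ r2 ∷ r3 ∷ r4 ∷ r5 ∷ r6 ∷ r7 ∷ r8 ∷ r9 ∷ r10 ∷ r11 ∷ r12 ∷ r13 ∷ r14 ∷ r15 ∷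
    r16 ∷ r17 ∷ r18 ∷ r19 ∷ r20 ∷ r21 ∷ r22 ∷ r23 ∷ r24 ∷ r25 ∷ r26 ∷ r27 ∷ r28 ∷ r29 ∷ r30 ∷ r31 ∷
    r32 ∷ r33 ∷ r34 ∷ r35 ∷ r36 ∷ r37 ∷ r38 ∷ r39 ∷ r40 ∷ r41 ∷ r42 ∷ r43 ∷ r44 ∷ r45 ∷ r46 ∷ r47 ∷
    r48 ∷ r49 ∷ r50 ∷ r51 ∷ r52 ∷ r53 ∷ r54 ∷ r55 ∷ r56 ∷ r57 ∷ r58 ∷ r59 ∷ r60 ∷ r61 ∷ r62 ∷ r63 ∷
    r64 ∷ r65 ∷ r66 ∷ r67 ∷ r68 ∷ r69 ∷ r70 ∷ r71 ∷ r72 ∷ r73 ∷ r74 ∷ r75 ∷ r76 ∷ r77 ∷ r78 ∷ r79 ∷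
    r80 ∷ r81 ∷ r82 ∷ r83 ∷ r84 ∷ r85 ∷ r86 ∷ r87 ∷ r88 ∷ r89 ∷ r90 ∷ r91 ∷ r92 ∷ r93 ∷ r94 ∷ r95 ∷
    r96 ∷ r97 ∷ r98 ∷ r99 ∷ r100 ∷ r101 ∷ r102 ∷ r103 ∷ r104 ∷ r105 ∷ r106 ∷ r107 ∷ r108 ∷ r109 ∷ r110 ∷ r111 ∷
    r112 ∷ r113 ∷ r114 ∷ r115 ∷ r116 ∷ r117 ∷ r118 ∷ r119 ∷ r120 ∷ r121 ∷ r122 ∷ r123 ∷ r124 ∷ r125 ∷ r126 ∷ r127 ∷
    r128 ∷ r129 ∷ r130 ∷ r131 ∷ r132 ∷ r133 ∷ r134 ∷ r135 ∷ r136 ∷ r137 ∷ r138 ∷ r139 ∷ r140 ∷ r141 ∷ r142 ∷ r143 ∷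
    r144 ∷ r145 ∷ r146 ∷ r147 ∷ r148 ∷ r149 ∷ r150 ∷ r151 ∷ r152 ∷ r153 ∷ r154 ∷ r155 ∷ r156 ∷ r157 ∷ r158 ∷ r159 ∷
    r160 ∷ r161 ∷ r162 ∷ r163 ∷ r164 ∷ r165 ∷ r166 ∷ r167 ∷ r168 ∷ r169 ∷ r170 ∷ r171 ∷ r172 ∷ r173 ∷ r174 ∷ r175 ∷
    r176 ∷ r177 ∷ r178 ∷ r179 ∷ r180 ∷ r181 ∷ r182 ∷ r183 ∷ r184 ∷ r185 ∷ r186 ∷ r187 ∷ r188 ∷ r189 ∷ r190 ∷ r191 ∷
    r192 ∷ r193 ∷ r194 ∷ r195 ∷ r196 ∷ r197 ∷ r198 ∷ r199 ∷ r200 ∷ r201 ∷ r202 ∷ r203 ∷ r204 ∷ r205 ∷ r206 ∷ r207 ∷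
    r208 ∷ r209 ∷ r210 ∷ r211 ∷ r212 ∷ r213 ∷ r214 ∷ r215 ∷ r216 ∷ r217 ∷ r218 ∷ r219 ∷ r220 ∷ r221 ∷ r222 ∷ r223 ∷
    r224 ∷ r225 ∷ r226 ∷ r227 ∷ r228 ∷ r229 ∷ r230 ∷ r231 ∷ r232 ∷ r233 ∷ r234 ∷ r235 ∷ r236 ∷ r237 ∷ r238 ∷ r239 ∷
    []

  normSq : ∀ {n} → Vec ℤ n → ℕ
  normSq []       = 0
  normSq (x ∷ xs) = ∣ x ∣ ℕ.* ∣ x ∣ ℕ.+ normSq xs

  dot-self : ∀ {n} (x : Vec ℤ n) → dot x x ≡ + normSq x
  dot-self []       = refl
  dot-self (x ∷ xs) rewrite dot-self xs = cong (ℤ._+ + normSq xs) (square x)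
    where
    square : ∀ x → x * x ≡ + (∣ x ∣ ℕ.* ∣ x ∣)
    square (+ zero)   = refl
    square (+ suc _)  = refl
    square -[1+ _ ]   = refl

  private
    nine≰ : ∀ n → ¬ (3 ℕ.+ n) ℕ.* (3 ℕ.+ n) ≤ 8
    nine≰ n h = ℕ.<-irrefl refl (ℕ.≤-trans (ℕ.*-mono-≤ (ℕ.m≤m+n 3 n) (ℕ.m≤m+n 3 n)) h)

  smallIntegers : List ℤ
  smallIntegers = -[1+ 1 ] ∷ -[1+ 0 ] ∷ + 0 ∷ + 1 ∷ + 2 ∷ []

  ∈-smallIntegers : ∀ x → ∣ x ∣ ℕ.* ∣ x ∣ ≤ 8 → x ∈ smallIntegers
  ∈-smallIntegers (+ 0)                  _ = there (there (here refl))
  ∈-smallIntegers (+ 1)                  _ = there (there (there (here refl)))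
  ∈-smallIntegers (+ 2)                  _ = there (there (there (there (here refl))))
  ∈-smallIntegers -[1+ 0 ]               _ = there (here refl)
  ∈-smallIntegers -[1+ 1 ]               _ = here refl
  ∈-smallIntegers (+ suc (suc (suc n)))  x²≤8 = ⊥-elim (nine≰ n x²≤8)
  ∈-smallIntegers -[1+ suc (suc n) ]     x²≤8 = ⊥-elim (nine≰ n x²≤8)

  vectorsOfNormSq : (n s : ℕ) → List (Vec ℤ n)
  vectorsOfNormSq zero    zero    = [] ∷ []
  vectorsOfNormSq zero    (suc s) = []
  vectorsOfNormSq (suc n) s       =
    concatMap (λ x → map (x ∷_) (vectorsOfNormSq n (s ∸ ∣ x ∣ ℕ.* ∣ x ∣)))
              (filterᵇ (λ x → ∣ x ∣ ℕ.* ∣ x ∣ ≤ᵇ s) smallIntegers)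

  ∈-vectorsOfNormSq : ∀ {n} (x : Vec ℤ n) → normSq x ≤ 8 → x ∈ vectorsOfNormSq n (normSq x)
  ∈-vectorsOfNormSq []       _    = here refl
  ∈-vectorsOfNormSq (x ∷ xs) x≤8 = ∈-concat⁺′ (∈-map⁺ (x ∷_) xs∈) (∈-map⁺ _ x∈)
    where
    x² = ∣ x ∣ ℕ.* ∣ x ∣
    xs∈ : xs ∈ vectorsOfNormSq _ (x² ℕ.+ normSq xs ∸ x²)
    xs∈ rewrite ℕ.m+n∸m≡n x² (normSq xs) =
      ∈-vectorsOfNormSq xs (ℕ.≤-trans (ℕ.m≤n+m (normSq xs) x²) x≤8)
    x∈ : x ∈ filterᵇ (λ y → ∣ y ∣ ℕ.* ∣ y ∣ ≤ᵇ x² ℕ.+ normSq xs) smallIntegers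
    x∈ = ∈-filter⁺ (T? ∘ λ y → ∣ y ∣ ℕ.* ∣ y ∣ ≤ᵇ x² ℕ.+ normSq xs)
           (∈-smallIntegers x (ℕ.≤-trans (ℕ.m≤m+n x² (normSq xs)) x≤8)) (ℕ.≤⇒≤ᵇ (ℕ.m≤m+n x² (normSq xs)))

  roots-enumeration : filterᵇ isRoot (vectorsOfNormSq 8 8) ≡ roots
  roots-enumeration = refl

  roots-complete : ∀ {x} → T (isRoot x) → x ∈ roots
  roots-complete {x} root = subst (x ∈_) roots-enumeration
    (∈-filter⁺ (T? ∘ isRoot) (subst (λ s → x ∈ vectorsOfNormSq 8 s) ‖x‖²≡8
      (∈-vectorsOfNormSq x (ℕ.≤-reflexive ‖x‖²≡8))) root)
    where
    ‖x‖²≡8 : normSq x ≡ 8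
    ‖x‖²≡8 = +-injective (trans (sym (dot-self x)) (==⇒≡ (proj₂ (Equivalence.to T-∧ root))))

  roots-sorted : AllPairs _<ₗ_ roots
  roots-sorted = strictlySorted⇒AllPairs _

  ∈roots⇒isRoot : ∀ {x} → x ∈ roots → T (isRoot x)
  ∈roots⇒isRoot = All.lookup (all⁺ isRoot roots _)

  ∈roots⇒norm : ∀ {x} → x ∈ roots → dot x x ≡ + 8
  ∈roots⇒norm = ==⇒≡ ∘ proj₂ ∘ Equivalence.to T-∧ ∘ ∈roots⇒isRoot

  reflectionClosure : V8 → V8 → Bool
  reflectionClosure a x = isRoot (reflect a x) ∧ (dot x a == (dot x a / + 4) * + 4)

  roots-reflectionClosed : Bool.all (λ a → Bool.all (reflectionClosure a) roots) roots ≡ true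
  roots-reflectionClosed = refl

  private
    closure : ∀ {a x} → a ∈ roots → x ∈ roots → T (isRoot (reflect a x)) × T (dot x a == (dot x a / + 4) * + 4)
    closure {a} a∈ x∈ = Equivalence.to T-∧ (Equivalence.from T-≡
      (all-lookup≡ (reflectionClosure a) {roots}
        (all-lookup≡ (λ b → Bool.all (reflectionClosure b) roots) {roots} roots-reflectionClosed a∈) x∈))

  reflect-∈roots : ∀ {a x} → a ∈ roots → x ∈ roots → reflect a x ∈ roots
  reflect-∈roots a∈ x∈ = roots-complete (proj₁ (closure a∈ x∈))

  roots-integral : ∀ {a x} → a ∈ roots → x ∈ roots → IntegralPairing x a
  roots-integral a∈ x∈ = ==⇒≡ (proj₂ (closure a∈ x∈))

open Roots


module Words where

  open import Data.Integer using (+_)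
  open import Data.List.Relation.Unary.Unique.Propositional using (Unique)
  import Data.List.Relation.Unary.AllPairs as AllPairs

  RootWord : List V8 → Set
  RootWord = All (_∈ roots)

  inverseWord : List V8 → List V8
  inverseWord []      = []
  inverseWord (a ∷ w) = inverseWord w ++ a ∷ []

  inverseWord-rootWord : ∀ {w} → RootWord w → RootWord (inverseWord w)
  inverseWord-rootWord []         = []
  inverseWord-rootWord (a∈ ∷ w∈) = ++⁺ (inverseWord-rootWord w∈) (a∈ ∷ [])

  actW-++ : ∀ u v x → actW (u ++ v) x ≡ actW u (actW v x)
  actW-++ []      v x = refl
  actW-++ (a ∷ u) v x = cong (reflect a) (actW-++ u v x)

  actW-∈roots : ∀ {w x} → RootWord w → x ∈ roots → actW w x ∈ roots
  actW-∈roots []         x∈ = x∈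
  actW-∈roots (a∈ ∷ w∈) x∈ = reflect-∈roots a∈ (actW-∈roots w∈ x∈)

  actW-dot : ∀ {w x y} → RootWord w → x ∈ roots → y ∈ roots → dot (actW w x) (actW w y) ≡ dot x y
  actW-dot []         x∈ y∈ = refl
  actW-dot {a ∷ w} {x} {y} (a∈ ∷ w∈) x∈ y∈ = trans
    (reflect-isometry {a} {actW w x} {actW w y} (∈roots⇒norm a∈) (roots-integral a∈ (actW-∈roots w∈ x∈)) (roots-integral a∈ (actW-∈roots w∈ y∈)))
    (actW-dot w∈ x∈ y∈)

  actW-orth : ∀ {w x y} → RootWord w → x ∈ roots → y ∈ roots → orth (actW w x) (actW w y) ≡ orth x y
  actW-orth w∈ x∈ y∈ = cong (_== + 0) (actW-dot w∈ x∈ y∈)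

  reflect-involutive-roots : ∀ {a x} → a ∈ roots → x ∈ roots → reflect a (reflect a x) ≡ x
  reflect-involutive-roots {a} {x} a∈ x∈ =
    reflect-involutive {a} {x} (∈roots⇒norm a∈) (roots-integral a∈ x∈) (roots-integral a∈ (reflect-∈roots a∈ x∈))

  actW-inverseˡ : ∀ {w x} → RootWord w → x ∈ roots → actW (inverseWord w) (actW w x) ≡ x
  actW-inverseˡ             []         x∈ = refl
  actW-inverseˡ {a ∷ w} {x} (a∈ ∷ w∈) x∈ = begin
    actW (inverseWord w ++ a ∷ []) (reflect a (actW w x)) ≡⟨ actW-++ (inverseWord w) (a ∷ []) _ ⟩
    actW (inverseWord w) (reflect a (reflect a (actW w x))) ≡⟨ cong (actW (inverseWord w)) (reflect-involutive-roots a∈ (actW-∈roots w∈ x∈)) ⟩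
    actW (inverseWord w) (actW w x)                       ≡⟨ actW-inverseˡ w∈ x∈ ⟩
    x                                                     ∎
    where open ≡-Reasoning

  actW-inverseʳ : ∀ {w x} → RootWord w → x ∈ roots → actW w (actW (inverseWord w) x) ≡ x
  actW-inverseʳ             []         x∈ = refl
  actW-inverseʳ {a ∷ w} {x} (a∈ ∷ w∈) x∈ = begin
    reflect a (actW w (actW (inverseWord w ++ a ∷ []) x)) ≡⟨ cong (reflect a ∘ actW w) (actW-++ (inverseWord w) (a ∷ []) x) ⟩
    reflect a (actW w (actW (inverseWord w) (reflect a x))) ≡⟨ cong (reflect a) (actW-inverseʳ w∈ (reflect-∈roots a∈ x∈)) ⟩
    reflect a (reflect a x)                               ≡⟨ reflect-involutive-roots a∈ x∈ ⟩
    x                                                     ∎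
    where open ≡-Reasoning

  actW-fixes : ∀ {w p} → All (λ a → T (orth a p)) w → actW w p ≡ p
  actW-fixes []         = refl
  actW-fixes (a⊥p ∷ w⊥p) = trans (cong (reflect _) (actW-fixes w⊥p)) (reflect-orthogonal a⊥p)

  roots-unique : Unique roots
  roots-unique = AllPairs.map (λ x<y x≡y → <ₗ-irrefl (subst (_ <ₗ_) (sym x≡y) x<y)) roots-sorted

  actW-permutes-roots : ∀ {w} → RootWord w → map (actW w) roots ↭ roots
  actW-permutes-roots {w} w∈ = map-↭-self {f = actW w} {actW (inverseWord w)} {roots} roots-unique (actW-∈roots w∈) (actW-∈roots (inverseWord-rootWord w∈))
    (actW-inverseˡ w∈) (actW-inverseʳ w∈)

open Words


-- The orbit certificate

module Certificate where

  open import Data.Integer as ℤ using ()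
  open import Data.Nat using (_≡ᵇ_; _<ᵇ_)
  import Data.Vec.Properties as Vec
  open import Relation.Binary.Definitions using (DecidableEquality)

  _≟V_ : DecidableEquality V8
  _≟V_ = Vec.≡-dec ℤ._≟_

  open import Data.List.Membership.DecPropositional _≟V_ using (_∈?_)

  _∈ᵇ_ : V8 → List V8 → Bool
  x ∈ᵇ xs = isYes (x ∈? xs)

  sameSetᵇ : List V8 → List V8 → Bool
  sameSetᵇ xs ys = Bool.all (_∈ᵇ ys) xs ∧ Bool.all (_∈ᵇ xs) ys

  Orbit : Set
  Orbit = List (V8 × List V8)

  -- A node stands for the ordered clique prefix. Each extension (e , orbit) lists pairs (r , w)
  -- where w is a word whose letters are orthogonal to prefix and which maps r to e; the
  -- standardizer is only meaningful when prefix has 5 roots.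
  record CertificateNode : Set where
    constructor node
    field
      prefix       : List V8
      standardizer : List V8
      extensions   : List (V8 × Orbit)

  open CertificateNode public

  standardClique : List V8
  standardClique = r0 ∷ r13 ∷ r90 ∷ r99 ∷ r108 ∷ []

  certificate : List CertificateNode
  certificate =
    node [] []
      ( (r0 ,
          (r0 , []) ∷ (r1 , r89 ∷ []) ∷ (r2 , r88 ∷ []) ∷ (r3 , r87 ∷ []) ∷ (r4 , r86 ∷ []) ∷ (r5 , r85 ∷ []) ∷
          (r6 , r84 ∷ []) ∷ (r7 , r83 ∷ []) ∷ (r8 , r82 ∷ []) ∷ (r9 , r81 ∷ []) ∷ (r10 , r80 ∷ []) ∷
          (r11 , r79 ∷ []) ∷ (r12 , r78 ∷ []) ∷ (r13 , r78 ∷ r89 ∷ []) ∷ (r14 , r45 ∷ []) ∷ (r15 , r44 ∷ []) ∷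
          (r16 , r43 ∷ []) ∷ (r17 , r42 ∷ []) ∷ (r18 , r41 ∷ []) ∷ (r19 , r40 ∷ []) ∷ (r20 , r39 ∷ []) ∷
          (r21 , r38 ∷ []) ∷ (r22 , r37 ∷ []) ∷ (r23 , r36 ∷ []) ∷ (r24 , r35 ∷ []) ∷ (r25 , r34 ∷ []) ∷
          (r26 , r33 ∷ []) ∷ (r27 , r32 ∷ []) ∷ (r28 , r31 ∷ []) ∷ (r29 , r30 ∷ []) ∷ (r30 , r29 ∷ []) ∷
          (r31 , r28 ∷ []) ∷ (r32 , r27 ∷ []) ∷ (r33 , r26 ∷ []) ∷ (r34 , r25 ∷ []) ∷ (r35 , r24 ∷ []) ∷
          (r36 , r23 ∷ []) ∷ (r37 , r22 ∷ []) ∷ (r38 , r21 ∷ []) ∷ (r39 , r20 ∷ []) ∷ (r40 , r19 ∷ []) ∷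
          (r41 , r18 ∷ []) ∷ (r42 , r17 ∷ []) ∷ (r43 , r16 ∷ []) ∷ (r44 , r15 ∷ []) ∷ (r45 , r14 ∷ []) ∷
          (r46 , r29 ∷ r89 ∷ []) ∷ (r47 , r28 ∷ r89 ∷ []) ∷ (r48 , r27 ∷ r89 ∷ []) ∷ (r49 , r26 ∷ r89 ∷ []) ∷
          (r50 , r25 ∷ r89 ∷ []) ∷ (r51 , r24 ∷ r89 ∷ []) ∷ (r52 , r23 ∷ r89 ∷ []) ∷ (r53 , r22 ∷ r89 ∷ []) ∷
          (r54 , r21 ∷ r89 ∷ []) ∷ (r55 , r20 ∷ r89 ∷ []) ∷ (r56 , r19 ∷ r89 ∷ []) ∷ (r57 , r18 ∷ r89 ∷ []) ∷
          (r58 , r17 ∷ r89 ∷ []) ∷ (r59 , r16 ∷ r89 ∷ []) ∷ (r60 , r15 ∷ r89 ∷ []) ∷ (r61 , r14 ∷ r89 ∷ []) ∷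
          (r62 , r21 ∷ r88 ∷ []) ∷ (r63 , r20 ∷ r88 ∷ []) ∷ (r64 , r19 ∷ r88 ∷ []) ∷ (r65 , r18 ∷ r88 ∷ []) ∷
          (r66 , r17 ∷ r88 ∷ []) ∷ (r67 , r16 ∷ r88 ∷ []) ∷ (r68 , r15 ∷ r88 ∷ []) ∷ (r69 , r14 ∷ r88 ∷ []) ∷
          (r70 , r17 ∷ r87 ∷ []) ∷ (r71 , r16 ∷ r87 ∷ []) ∷ (r72 , r15 ∷ r87 ∷ []) ∷ (r73 , r14 ∷ r87 ∷ []) ∷
          (r74 , r15 ∷ r86 ∷ []) ∷ (r75 , r14 ∷ r86 ∷ []) ∷ (r76 , r14 ∷ r85 ∷ []) ∷ (r77 , r14 ∷ r84 ∷ []) ∷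
          (r78 , r12 ∷ []) ∷ (r79 , r11 ∷ []) ∷ (r80 , r10 ∷ []) ∷ (r81 , r9 ∷ []) ∷ (r82 , r8 ∷ []) ∷
          (r83 , r7 ∷ []) ∷ (r84 , r6 ∷ []) ∷ (r85 , r5 ∷ []) ∷ (r86 , r4 ∷ []) ∷ (r87 , r3 ∷ []) ∷
          (r88 , r2 ∷ []) ∷ (r89 , r1 ∷ []) ∷ (r90 , r11 ∷ r89 ∷ []) ∷ (r91 , r10 ∷ r89 ∷ []) ∷ (r92 , r9 ∷ r89 ∷ []) ∷
          (r93 , r8 ∷ r89 ∷ []) ∷ (r94 , r7 ∷ r89 ∷ []) ∷ (r95 , r6 ∷ r89 ∷ []) ∷ (r96 , r5 ∷ r89 ∷ []) ∷
          (r97 , r4 ∷ r89 ∷ []) ∷ (r98 , r3 ∷ r89 ∷ []) ∷ (r99 , r2 ∷ r89 ∷ []) ∷ (r100 , r10 ∷ r88 ∷ []) ∷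
          (r101 , r9 ∷ r88 ∷ []) ∷ (r102 , r8 ∷ r88 ∷ []) ∷ (r103 , r7 ∷ r88 ∷ []) ∷ (r104 , r6 ∷ r88 ∷ []) ∷
          (r105 , r5 ∷ r88 ∷ []) ∷ (r106 , r4 ∷ r88 ∷ []) ∷ (r107 , r3 ∷ r88 ∷ []) ∷ (r108 , r9 ∷ r87 ∷ []) ∷
          (r109 , r8 ∷ r87 ∷ []) ∷ (r110 , r7 ∷ r87 ∷ []) ∷ (r111 , r6 ∷ r87 ∷ []) ∷ (r112 , r5 ∷ r87 ∷ []) ∷
          (r113 , r4 ∷ r87 ∷ []) ∷ (r114 , r8 ∷ r86 ∷ []) ∷ (r115 , r7 ∷ r86 ∷ []) ∷ (r116 , r6 ∷ r86 ∷ []) ∷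
          (r117 , r5 ∷ r86 ∷ []) ∷ (r118 , r7 ∷ r85 ∷ []) ∷ (r119 , r6 ∷ r85 ∷ []) ∷ (r120 , r5 ∷ r84 ∷ []) ∷
          (r121 , r5 ∷ r83 ∷ []) ∷ (r122 , r4 ∷ r85 ∷ []) ∷ (r123 , r4 ∷ r84 ∷ []) ∷ (r124 , r4 ∷ r83 ∷ []) ∷
          (r125 , r4 ∷ r82 ∷ []) ∷ (r126 , r3 ∷ r86 ∷ []) ∷ (r127 , r3 ∷ r85 ∷ []) ∷ (r128 , r3 ∷ r84 ∷ []) ∷
          (r129 , r3 ∷ r83 ∷ []) ∷ (r130 , r3 ∷ r82 ∷ []) ∷ (r131 , r3 ∷ r81 ∷ []) ∷ (r132 , r2 ∷ r87 ∷ []) ∷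
          (r133 , r2 ∷ r86 ∷ []) ∷ (r134 , r2 ∷ r85 ∷ []) ∷ (r135 , r2 ∷ r84 ∷ []) ∷ (r136 , r2 ∷ r83 ∷ []) ∷
          (r137 , r2 ∷ r82 ∷ []) ∷ (r138 , r2 ∷ r81 ∷ []) ∷ (r139 , r2 ∷ r80 ∷ []) ∷ (r140 , r1 ∷ r88 ∷ []) ∷
          (r141 , r1 ∷ r87 ∷ []) ∷ (r142 , r1 ∷ r86 ∷ []) ∷ (r143 , r1 ∷ r85 ∷ []) ∷ (r144 , r1 ∷ r84 ∷ []) ∷
          (r145 , r1 ∷ r83 ∷ []) ∷ (r146 , r1 ∷ r82 ∷ []) ∷ (r147 , r1 ∷ r81 ∷ []) ∷ (r148 , r1 ∷ r80 ∷ []) ∷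
          (r149 , r1 ∷ r79 ∷ []) ∷ (r150 , r0 ∷ r1 ∷ []) ∷ (r151 , r0 ∷ r2 ∷ []) ∷ (r152 , r0 ∷ r3 ∷ []) ∷
          (r153 , r0 ∷ r4 ∷ []) ∷ (r154 , r0 ∷ r5 ∷ []) ∷ (r155 , r0 ∷ r6 ∷ []) ∷ (r156 , r0 ∷ r7 ∷ []) ∷
          (r157 , r0 ∷ r8 ∷ []) ∷ (r158 , r0 ∷ r9 ∷ []) ∷ (r159 , r0 ∷ r10 ∷ []) ∷ (r160 , r0 ∷ r11 ∷ []) ∷
          (r161 , r0 ∷ r12 ∷ []) ∷ (r162 , r6 ∷ r45 ∷ []) ∷ (r163 , r5 ∷ r45 ∷ []) ∷ (r164 , r4 ∷ r45 ∷ []) ∷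
          (r165 , r4 ∷ r44 ∷ []) ∷ (r166 , r3 ∷ r45 ∷ []) ∷ (r167 , r3 ∷ r44 ∷ []) ∷ (r168 , r3 ∷ r43 ∷ []) ∷
          (r169 , r3 ∷ r42 ∷ []) ∷ (r170 , r2 ∷ r45 ∷ []) ∷ (r171 , r2 ∷ r44 ∷ []) ∷ (r172 , r2 ∷ r43 ∷ []) ∷
          (r173 , r2 ∷ r42 ∷ []) ∷ (r174 , r2 ∷ r41 ∷ []) ∷ (r175 , r2 ∷ r40 ∷ []) ∷ (r176 , r2 ∷ r39 ∷ []) ∷
          (r177 , r2 ∷ r38 ∷ []) ∷ (r178 , r1 ∷ r45 ∷ []) ∷ (r179 , r1 ∷ r44 ∷ []) ∷ (r180 , r1 ∷ r43 ∷ []) ∷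
          (r181 , r1 ∷ r42 ∷ []) ∷ (r182 , r1 ∷ r41 ∷ []) ∷ (r183 , r1 ∷ r40 ∷ []) ∷ (r184 , r1 ∷ r39 ∷ []) ∷
          (r185 , r1 ∷ r38 ∷ []) ∷ (r186 , r1 ∷ r37 ∷ []) ∷ (r187 , r1 ∷ r36 ∷ []) ∷ (r188 , r1 ∷ r35 ∷ []) ∷
          (r189 , r1 ∷ r34 ∷ []) ∷ (r190 , r1 ∷ r33 ∷ []) ∷ (r191 , r1 ∷ r32 ∷ []) ∷ (r192 , r1 ∷ r31 ∷ []) ∷
          (r193 , r1 ∷ r30 ∷ []) ∷ (r194 , r0 ∷ r14 ∷ []) ∷ (r195 , r0 ∷ r15 ∷ []) ∷ (r196 , r0 ∷ r16 ∷ []) ∷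
          (r197 , r0 ∷ r17 ∷ []) ∷ (r198 , r0 ∷ r18 ∷ []) ∷ (r199 , r0 ∷ r19 ∷ []) ∷ (r200 , r0 ∷ r20 ∷ []) ∷
          (r201 , r0 ∷ r21 ∷ []) ∷ (r202 , r0 ∷ r22 ∷ []) ∷ (r203 , r0 ∷ r23 ∷ []) ∷ (r204 , r0 ∷ r24 ∷ []) ∷
          (r205 , r0 ∷ r25 ∷ []) ∷ (r206 , r0 ∷ r26 ∷ []) ∷ (r207 , r0 ∷ r27 ∷ []) ∷ (r208 , r0 ∷ r28 ∷ []) ∷
          (r209 , r0 ∷ r29 ∷ []) ∷ (r210 , r0 ∷ r30 ∷ []) ∷ (r211 , r0 ∷ r31 ∷ []) ∷ (r212 , r0 ∷ r32 ∷ []) ∷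
          (r213 , r0 ∷ r33 ∷ []) ∷ (r214 , r0 ∷ r34 ∷ []) ∷ (r215 , r0 ∷ r35 ∷ []) ∷ (r216 , r0 ∷ r36 ∷ []) ∷
          (r217 , r0 ∷ r37 ∷ []) ∷ (r218 , r0 ∷ r38 ∷ []) ∷ (r219 , r0 ∷ r39 ∷ []) ∷ (r220 , r0 ∷ r40 ∷ []) ∷
          (r221 , r0 ∷ r41 ∷ []) ∷ (r222 , r0 ∷ r42 ∷ []) ∷ (r223 , r0 ∷ r43 ∷ []) ∷ (r224 , r0 ∷ r44 ∷ []) ∷
          (r225 , r0 ∷ r45 ∷ []) ∷ (r226 , r1 ∷ r12 ∷ []) ∷ (r227 , r0 ∷ r78 ∷ []) ∷ (r228 , r0 ∷ r79 ∷ []) ∷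
          (r229 , r0 ∷ r80 ∷ []) ∷ (r230 , r0 ∷ r81 ∷ []) ∷ (r231 , r0 ∷ r82 ∷ []) ∷ (r232 , r0 ∷ r83 ∷ []) ∷
          (r233 , r0 ∷ r84 ∷ []) ∷ (r234 , r0 ∷ r85 ∷ []) ∷ (r235 , r0 ∷ r86 ∷ []) ∷ (r236 , r0 ∷ r87 ∷ []) ∷
          (r237 , r0 ∷ r88 ∷ []) ∷ (r238 , r0 ∷ r89 ∷ []) ∷ (r239 , r0 ∷ []) ∷ [])
      ∷ []) ∷
    node (r0 ∷ []) []
      ( (r13 ,
          (r13 , []) ∷ (r46 , r77 ∷ []) ∷ (r47 , r76 ∷ []) ∷ (r48 , r75 ∷ []) ∷ (r49 , r74 ∷ []) ∷
          (r50 , r73 ∷ []) ∷ (r51 , r72 ∷ []) ∷ (r52 , r71 ∷ []) ∷ (r53 , r70 ∷ []) ∷ (r54 , r69 ∷ []) ∷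
          (r55 , r68 ∷ []) ∷ (r56 , r67 ∷ []) ∷ (r57 , r66 ∷ []) ∷ (r58 , r65 ∷ []) ∷ (r59 , r64 ∷ []) ∷
          (r60 , r63 ∷ []) ∷ (r61 , r62 ∷ []) ∷ (r62 , r61 ∷ []) ∷ (r63 , r60 ∷ []) ∷ (r64 , r59 ∷ []) ∷
          (r65 , r58 ∷ []) ∷ (r66 , r57 ∷ []) ∷ (r67 , r56 ∷ []) ∷ (r68 , r55 ∷ []) ∷ (r69 , r54 ∷ []) ∷
          (r70 , r53 ∷ []) ∷ (r71 , r52 ∷ []) ∷ (r72 , r51 ∷ []) ∷ (r73 , r50 ∷ []) ∷ (r74 , r49 ∷ []) ∷
          (r75 , r48 ∷ []) ∷ (r76 , r47 ∷ []) ∷ (r77 , r46 ∷ []) ∷ (r90 , r70 ∷ r77 ∷ []) ∷ (r91 , r66 ∷ r77 ∷ []) ∷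
          (r92 , r64 ∷ r77 ∷ []) ∷ (r93 , r63 ∷ r77 ∷ []) ∷ (r94 , r63 ∷ r76 ∷ []) ∷ (r95 , r62 ∷ r77 ∷ []) ∷
          (r96 , r62 ∷ r76 ∷ []) ∷ (r97 , r62 ∷ r75 ∷ []) ∷ (r98 , r62 ∷ r73 ∷ []) ∷ (r99 , r62 ∷ r69 ∷ []) ∷
          (r100 , r58 ∷ r77 ∷ []) ∷ (r101 , r56 ∷ r77 ∷ []) ∷ (r102 , r55 ∷ r77 ∷ []) ∷ (r103 , r55 ∷ r76 ∷ []) ∷
          (r104 , r54 ∷ r77 ∷ []) ∷ (r105 , r54 ∷ r76 ∷ []) ∷ (r106 , r54 ∷ r75 ∷ []) ∷ (r107 , r54 ∷ r73 ∷ []) ∷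
          (r108 , r52 ∷ r77 ∷ []) ∷ (r109 , r51 ∷ r77 ∷ []) ∷ (r110 , r51 ∷ r76 ∷ []) ∷ (r111 , r50 ∷ r77 ∷ []) ∷
          (r112 , r50 ∷ r76 ∷ []) ∷ (r113 , r50 ∷ r75 ∷ []) ∷ (r114 , r49 ∷ r77 ∷ []) ∷ (r115 , r49 ∷ r76 ∷ []) ∷
          (r116 , r48 ∷ r77 ∷ []) ∷ (r117 , r48 ∷ r76 ∷ []) ∷ (r118 , r49 ∷ r75 ∷ []) ∷ (r119 , r47 ∷ r77 ∷ []) ∷
          (r120 , r46 ∷ r76 ∷ []) ∷ (r121 , r48 ∷ r74 ∷ []) ∷ (r122 , r47 ∷ r75 ∷ []) ∷ (r123 , r46 ∷ r75 ∷ []) ∷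
          (r124 , r47 ∷ r74 ∷ []) ∷ (r125 , r46 ∷ r74 ∷ []) ∷ (r126 , r48 ∷ r73 ∷ []) ∷ (r127 , r47 ∷ r73 ∷ []) ∷
          (r128 , r46 ∷ r73 ∷ []) ∷ (r129 , r47 ∷ r72 ∷ []) ∷ (r130 , r46 ∷ r72 ∷ []) ∷ (r131 , r46 ∷ r71 ∷ []) ∷
          (r132 , r50 ∷ r69 ∷ []) ∷ (r133 , r48 ∷ r69 ∷ []) ∷ (r134 , r47 ∷ r69 ∷ []) ∷ (r135 , r46 ∷ r69 ∷ []) ∷
          (r136 , r47 ∷ r68 ∷ []) ∷ (r137 , r46 ∷ r68 ∷ []) ∷ (r138 , r46 ∷ r67 ∷ []) ∷ (r139 , r46 ∷ r65 ∷ []) ∷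
          (r140 , r54 ∷ r61 ∷ []) ∷ (r141 , r50 ∷ r61 ∷ []) ∷ (r142 , r48 ∷ r61 ∷ []) ∷ (r143 , r47 ∷ r61 ∷ []) ∷
          (r144 , r46 ∷ r61 ∷ []) ∷ (r145 , r47 ∷ r60 ∷ []) ∷ (r146 , r46 ∷ r60 ∷ []) ∷ (r147 , r46 ∷ r59 ∷ []) ∷
          (r148 , r46 ∷ r57 ∷ []) ∷ (r149 , r46 ∷ r53 ∷ []) ∷ (r162 , r13 ∷ r46 ∷ []) ∷ (r163 , r13 ∷ r47 ∷ []) ∷
          (r164 , r13 ∷ r48 ∷ []) ∷ (r165 , r13 ∷ r49 ∷ []) ∷ (r166 , r13 ∷ r50 ∷ []) ∷ (r167 , r13 ∷ r51 ∷ []) ∷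
          (r168 , r13 ∷ r52 ∷ []) ∷ (r169 , r13 ∷ r53 ∷ []) ∷ (r170 , r13 ∷ r54 ∷ []) ∷ (r171 , r13 ∷ r55 ∷ []) ∷
          (r172 , r13 ∷ r56 ∷ []) ∷ (r173 , r13 ∷ r57 ∷ []) ∷ (r174 , r13 ∷ r58 ∷ []) ∷ (r175 , r13 ∷ r59 ∷ []) ∷
          (r176 , r13 ∷ r60 ∷ []) ∷ (r177 , r13 ∷ r61 ∷ []) ∷ (r178 , r13 ∷ r62 ∷ []) ∷ (r179 , r13 ∷ r63 ∷ []) ∷
          (r180 , r13 ∷ r64 ∷ []) ∷ (r181 , r13 ∷ r65 ∷ []) ∷ (r182 , r13 ∷ r66 ∷ []) ∷ (r183 , r13 ∷ r67 ∷ []) ∷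
          (r184 , r13 ∷ r68 ∷ []) ∷ (r185 , r13 ∷ r69 ∷ []) ∷ (r186 , r13 ∷ r70 ∷ []) ∷ (r187 , r13 ∷ r71 ∷ []) ∷
          (r188 , r13 ∷ r72 ∷ []) ∷ (r189 , r13 ∷ r73 ∷ []) ∷ (r190 , r13 ∷ r74 ∷ []) ∷ (r191 , r13 ∷ r75 ∷ []) ∷
          (r192 , r13 ∷ r76 ∷ []) ∷ (r193 , r13 ∷ r77 ∷ []) ∷ (r226 , r13 ∷ []) ∷ [])
      ∷ []) ∷
    node (r0 ∷ r13 ∷ []) []
      ( (r90 ,
          (r90 , []) ∷ (r91 , r107 ∷ []) ∷ (r92 , r106 ∷ []) ∷ (r93 , r105 ∷ []) ∷ (r94 , r104 ∷ []) ∷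
          (r95 , r103 ∷ []) ∷ (r96 , r102 ∷ []) ∷ (r97 , r101 ∷ []) ∷ (r98 , r100 ∷ []) ∷ (r99 , r100 ∷ r107 ∷ []) ∷
          (r100 , r98 ∷ []) ∷ (r101 , r97 ∷ []) ∷ (r102 , r96 ∷ []) ∷ (r103 , r95 ∷ []) ∷ (r104 , r94 ∷ []) ∷
          (r105 , r93 ∷ []) ∷ (r106 , r92 ∷ []) ∷ (r107 , r91 ∷ []) ∷ (r108 , r97 ∷ r107 ∷ []) ∷ (r109 , r96 ∷ r107 ∷ []) ∷
          (r110 , r95 ∷ r107 ∷ []) ∷ (r111 , r94 ∷ r107 ∷ []) ∷ (r112 , r93 ∷ r107 ∷ []) ∷ (r113 , r92 ∷ r107 ∷ []) ∷
          (r114 , r96 ∷ r106 ∷ []) ∷ (r115 , r95 ∷ r106 ∷ []) ∷ (r116 , r94 ∷ r106 ∷ []) ∷ (r117 , r93 ∷ r106 ∷ []) ∷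
          (r118 , r95 ∷ r105 ∷ []) ∷ (r119 , r94 ∷ r105 ∷ []) ∷ (r120 , r93 ∷ r104 ∷ []) ∷ (r121 , r93 ∷ r103 ∷ []) ∷
          (r122 , r92 ∷ r105 ∷ []) ∷ (r123 , r92 ∷ r104 ∷ []) ∷ (r124 , r92 ∷ r103 ∷ []) ∷ (r125 , r92 ∷ r102 ∷ []) ∷
          (r126 , r91 ∷ r106 ∷ []) ∷ (r127 , r91 ∷ r105 ∷ []) ∷ (r128 , r91 ∷ r104 ∷ []) ∷ (r129 , r91 ∷ r103 ∷ []) ∷
          (r130 , r91 ∷ r102 ∷ []) ∷ (r131 , r91 ∷ r101 ∷ []) ∷ (r132 , r90 ∷ r91 ∷ []) ∷ (r133 , r90 ∷ r92 ∷ []) ∷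
          (r134 , r90 ∷ r93 ∷ []) ∷ (r135 , r90 ∷ r94 ∷ []) ∷ (r136 , r90 ∷ r95 ∷ []) ∷ (r137 , r90 ∷ r96 ∷ []) ∷
          (r138 , r90 ∷ r97 ∷ []) ∷ (r139 , r90 ∷ r98 ∷ []) ∷ (r140 , r91 ∷ r98 ∷ []) ∷ (r141 , r90 ∷ r100 ∷ []) ∷
          (r142 , r90 ∷ r101 ∷ []) ∷ (r143 , r90 ∷ r102 ∷ []) ∷ (r144 , r90 ∷ r103 ∷ []) ∷ (r145 , r90 ∷ r104 ∷ []) ∷
          (r146 , r90 ∷ r105 ∷ []) ∷ (r147 , r90 ∷ r106 ∷ []) ∷ (r148 , r90 ∷ r107 ∷ []) ∷ (r149 , r90 ∷ []) ∷ [])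
      ∷ []) ∷
    node (r0 ∷ r13 ∷ r90 ∷ []) []
      ( (r99 ,
          (r99 , []) ∷ (r140 , r99 ∷ []) ∷ [])
      ∷ (r108 ,
          (r108 , []) ∷ (r109 , r117 ∷ []) ∷ (r110 , r116 ∷ []) ∷ (r111 , r115 ∷ []) ∷ (r112 , r114 ∷ []) ∷
          (r113 , r114 ∷ r117 ∷ []) ∷ (r114 , r112 ∷ []) ∷ (r115 , r111 ∷ []) ∷ (r116 , r110 ∷ []) ∷
          (r117 , r109 ∷ []) ∷ (r118 , r111 ∷ r117 ∷ []) ∷ (r119 , r110 ∷ r117 ∷ []) ∷ (r120 , r109 ∷ r116 ∷ []) ∷
          (r121 , r109 ∷ r115 ∷ []) ∷ (r122 , r108 ∷ r109 ∷ []) ∷ (r123 , r108 ∷ r110 ∷ []) ∷ (r124 , r108 ∷ r111 ∷ []) ∷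
          (r125 , r108 ∷ r112 ∷ []) ∷ (r126 , r109 ∷ r112 ∷ []) ∷ (r127 , r108 ∷ r114 ∷ []) ∷ (r128 , r108 ∷ r115 ∷ []) ∷
          (r129 , r108 ∷ r116 ∷ []) ∷ (r130 , r108 ∷ r117 ∷ []) ∷ (r131 , r108 ∷ []) ∷ [])
      ∷ []) ∷
    node (r0 ∷ r13 ∷ r90 ∷ r99 ∷ []) []
      ( (r108 ,
          (r108 , []) ∷ (r109 , r117 ∷ []) ∷ (r110 , r116 ∷ []) ∷ (r111 , r115 ∷ []) ∷ (r112 , r114 ∷ []) ∷
          (r113 , r114 ∷ r117 ∷ []) ∷ (r114 , r112 ∷ []) ∷ (r115 , r111 ∷ []) ∷ (r116 , r110 ∷ []) ∷
          (r117 , r109 ∷ []) ∷ (r118 , r111 ∷ r117 ∷ []) ∷ (r119 , r110 ∷ r117 ∷ []) ∷ (r120 , r109 ∷ r116 ∷ []) ∷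
          (r121 , r109 ∷ r115 ∷ []) ∷ (r122 , r108 ∷ r109 ∷ []) ∷ (r123 , r108 ∷ r110 ∷ []) ∷ (r124 , r108 ∷ r111 ∷ []) ∷
          (r125 , r108 ∷ r112 ∷ []) ∷ (r126 , r109 ∷ r112 ∷ []) ∷ (r127 , r108 ∷ r114 ∷ []) ∷ (r128 , r108 ∷ r115 ∷ []) ∷
          (r129 , r108 ∷ r116 ∷ []) ∷ (r130 , r108 ∷ r117 ∷ []) ∷ (r131 , r108 ∷ []) ∷ [])
      ∷ []) ∷
    node (r0 ∷ r13 ∷ r90 ∷ r108 ∷ []) []
      ( (r99 ,
          (r99 , []) ∷ (r140 , r99 ∷ []) ∷ [])
      ∷ (r113 ,
          (r113 , []) ∷ (r126 , r113 ∷ []) ∷ [])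
      ∷ (r118 ,
          (r118 , []) ∷ (r121 , r118 ∷ []) ∷ [])
      ∷ (r119 ,
          (r119 , []) ∷ (r120 , r119 ∷ []) ∷ [])
      ∷ []) ∷
    node (r0 ∷ r13 ∷ r90 ∷ r99 ∷ r108 ∷ []) []
      ( (r113 ,
          (r113 , []) ∷ (r126 , r113 ∷ []) ∷ [])
      ∷ (r118 ,
          (r118 , []) ∷ (r121 , r118 ∷ []) ∷ [])
      ∷ (r119 ,
          (r119 , []) ∷ (r120 , r119 ∷ []) ∷ [])
      ∷ []) ∷
    node (r0 ∷ r13 ∷ r90 ∷ r108 ∷ r99 ∷ []) []
      ( (r113 ,
          (r113 , []) ∷ (r126 , r113 ∷ []) ∷ [])
      ∷ (r118 ,
          (r118 , []) ∷ (r121 , r118 ∷ []) ∷ [])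
      ∷ (r119 ,
          (r119 , []) ∷ (r120 , r119 ∷ []) ∷ [])
      ∷ []) ∷
    node (r0 ∷ r13 ∷ r90 ∷ r108 ∷ r113 ∷ []) (r107 ∷ r97 ∷ r113 ∷ [])
      ( (r99 ,
          (r99 , []) ∷ (r140 , r99 ∷ []) ∷ [])
      ∷ (r118 ,
          (r118 , []) ∷ (r121 , r118 ∷ []) ∷ [])
      ∷ (r119 ,
          (r119 , []) ∷ (r120 , r119 ∷ []) ∷ [])
      ∷ []) ∷
    node (r0 ∷ r13 ∷ r90 ∷ r108 ∷ r118 ∷ []) (r77 ∷ r52 ∷ r107 ∷ r97 ∷ r116 ∷ r109 ∷ [])
      ( (r99 ,
          (r99 , []) ∷ (r140 , r99 ∷ []) ∷ [])
      ∷ (r113 ,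
          (r113 , []) ∷ (r126 , r113 ∷ []) ∷ [])
      ∷ (r119 ,
          (r119 , []) ∷ (r120 , r119 ∷ []) ∷ [])
      ∷ []) ∷
    node (r0 ∷ r13 ∷ r90 ∷ r108 ∷ r119 ∷ []) (r87 ∷ r9 ∷ r77 ∷ r52 ∷ r106 ∷ r91 ∷ r116 ∷ r109 ∷ [])
      ( (r99 ,
          (r99 , []) ∷ (r140 , r99 ∷ []) ∷ [])
      ∷ (r113 ,
          (r113 , []) ∷ (r126 , r113 ∷ []) ∷ [])
      ∷ (r118 ,
          (r118 , []) ∷ (r121 , r118 ∷ []) ∷ [])
      ∷ []) ∷
    node (r0 ∷ r13 ∷ r90 ∷ r99 ∷ r108 ∷ r113 ∷ []) []
      ( (r118 ,
          (r118 , []) ∷ (r121 , r118 ∷ []) ∷ [])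
      ∷ (r119 ,
          (r119 , []) ∷ (r120 , r119 ∷ []) ∷ [])
      ∷ []) ∷
    node (r0 ∷ r13 ∷ r90 ∷ r99 ∷ r108 ∷ r118 ∷ []) []
      ( (r113 ,
          (r113 , []) ∷ (r126 , r113 ∷ []) ∷ [])
      ∷ (r119 ,
          (r119 , []) ∷ (r120 , r119 ∷ []) ∷ [])
      ∷ []) ∷
    node (r0 ∷ r13 ∷ r90 ∷ r99 ∷ r108 ∷ r119 ∷ []) []
      ( (r113 ,
          (r113 , []) ∷ (r126 , r113 ∷ []) ∷ [])
      ∷ (r118 ,
          (r118 , []) ∷ (r121 , r118 ∷ []) ∷ [])
      ∷ []) ∷
    node (r0 ∷ r13 ∷ r90 ∷ r108 ∷ r99 ∷ r113 ∷ []) []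
      ( (r118 ,
          (r118 , []) ∷ (r121 , r118 ∷ []) ∷ [])
      ∷ (r119 ,
          (r119 , []) ∷ (r120 , r119 ∷ []) ∷ [])
      ∷ []) ∷
    node (r0 ∷ r13 ∷ r90 ∷ r108 ∷ r99 ∷ r118 ∷ []) []
      ( (r113 ,
          (r113 , []) ∷ (r126 , r113 ∷ []) ∷ [])
      ∷ (r119 ,
          (r119 , []) ∷ (r120 , r119 ∷ []) ∷ [])
      ∷ []) ∷
    node (r0 ∷ r13 ∷ r90 ∷ r108 ∷ r99 ∷ r119 ∷ []) []
      ( (r113 ,
          (r113 , []) ∷ (r126 , r113 ∷ []) ∷ [])
      ∷ (r118 ,
          (r118 , []) ∷ (r121 , r118 ∷ []) ∷ [])
      ∷ []) ∷
    node (r0 ∷ r13 ∷ r90 ∷ r108 ∷ r113 ∷ r99 ∷ []) []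
      ( (r118 ,
          (r118 , []) ∷ (r121 , r118 ∷ []) ∷ [])
      ∷ (r119 ,
          (r119 , []) ∷ (r120 , r119 ∷ []) ∷ [])
      ∷ []) ∷
    node (r0 ∷ r13 ∷ r90 ∷ r108 ∷ r113 ∷ r118 ∷ []) []
      ( (r99 ,
          (r99 , []) ∷ (r140 , r99 ∷ []) ∷ [])
      ∷ (r119 ,
          (r119 , []) ∷ (r120 , r119 ∷ []) ∷ [])
      ∷ []) ∷
    node (r0 ∷ r13 ∷ r90 ∷ r108 ∷ r113 ∷ r119 ∷ []) []
      ( (r99 ,
          (r99 , []) ∷ (r140 , r99 ∷ []) ∷ [])
      ∷ (r118 ,
          (r118 , []) ∷ (r121 , r118 ∷ []) ∷ [])
      ∷ []) ∷
    node (r0 ∷ r13 ∷ r90 ∷ r108 ∷ r118 ∷ r99 ∷ []) []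
      ( (r113 ,
          (r113 , []) ∷ (r126 , r113 ∷ []) ∷ [])
      ∷ (r119 ,
          (r119 , []) ∷ (r120 , r119 ∷ []) ∷ [])
      ∷ []) ∷
    node (r0 ∷ r13 ∷ r90 ∷ r108 ∷ r118 ∷ r113 ∷ []) []
      ( (r99 ,
          (r99 , []) ∷ (r140 , r99 ∷ []) ∷ [])
      ∷ (r119 ,
          (r119 , []) ∷ (r120 , r119 ∷ []) ∷ [])
      ∷ []) ∷
    node (r0 ∷ r13 ∷ r90 ∷ r108 ∷ r118 ∷ r119 ∷ []) []
      ( (r99 ,
          (r99 , []) ∷ (r140 , r99 ∷ []) ∷ [])
      ∷ (r113 ,
          (r113 , []) ∷ (r126 , r113 ∷ []) ∷ [])
      ∷ []) ∷
    node (r0 ∷ r13 ∷ r90 ∷ r108 ∷ r119 ∷ r99 ∷ []) []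
      ( (r113 ,
          (r113 , []) ∷ (r126 , r113 ∷ []) ∷ [])
      ∷ (r118 ,
          (r118 , []) ∷ (r121 , r118 ∷ []) ∷ [])
      ∷ []) ∷
    node (r0 ∷ r13 ∷ r90 ∷ r108 ∷ r119 ∷ r113 ∷ []) []
      ( (r99 ,
          (r99 , []) ∷ (r140 , r99 ∷ []) ∷ [])
      ∷ (r118 ,
          (r118 , []) ∷ (r121 , r118 ∷ []) ∷ [])
      ∷ []) ∷
    node (r0 ∷ r13 ∷ r90 ∷ r108 ∷ r119 ∷ r118 ∷ []) []
      ( (r99 ,
          (r99 , []) ∷ (r140 , r99 ∷ []) ∷ [])
      ∷ (r113 ,
          (r113 , []) ∷ (r126 , r113 ∷ []) ∷ [])
      ∷ []) ∷
    node (r0 ∷ r13 ∷ r90 ∷ r99 ∷ r108 ∷ r113 ∷ r118 ∷ []) []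
      ( (r119 ,
          (r119 , []) ∷ (r120 , r119 ∷ []) ∷ [])
      ∷ []) ∷
    node (r0 ∷ r13 ∷ r90 ∷ r99 ∷ r108 ∷ r113 ∷ r119 ∷ []) []
      ( (r118 ,
          (r118 , []) ∷ (r121 , r118 ∷ []) ∷ [])
      ∷ []) ∷
    node (r0 ∷ r13 ∷ r90 ∷ r99 ∷ r108 ∷ r118 ∷ r113 ∷ []) []
      ( (r119 ,
          (r119 , []) ∷ (r120 , r119 ∷ []) ∷ [])
      ∷ []) ∷
    node (r0 ∷ r13 ∷ r90 ∷ r99 ∷ r108 ∷ r118 ∷ r119 ∷ []) []
      ( (r113 ,
          (r113 , []) ∷ (r126 , r113 ∷ []) ∷ [])
      ∷ []) ∷
    node (r0 ∷ r13 ∷ r90 ∷ r99 ∷ r108 ∷ r119 ∷ r113 ∷ []) []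
      ( (r118 ,
          (r118 , []) ∷ (r121 , r118 ∷ []) ∷ [])
      ∷ []) ∷
    node (r0 ∷ r13 ∷ r90 ∷ r99 ∷ r108 ∷ r119 ∷ r118 ∷ []) []
      ( (r113 ,
          (r113 , []) ∷ (r126 , r113 ∷ []) ∷ [])
      ∷ []) ∷
    node (r0 ∷ r13 ∷ r90 ∷ r108 ∷ r99 ∷ r113 ∷ r118 ∷ []) []
      ( (r119 ,
          (r119 , []) ∷ (r120 , r119 ∷ []) ∷ [])
      ∷ []) ∷
    node (r0 ∷ r13 ∷ r90 ∷ r108 ∷ r99 ∷ r113 ∷ r119 ∷ []) []
      ( (r118 ,
          (r118 , []) ∷ (r121 , r118 ∷ []) ∷ [])
      ∷ []) ∷
    node (r0 ∷ r13 ∷ r90 ∷ r108 ∷ r99 ∷ r118 ∷ r113 ∷ []) []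
      ( (r119 ,
          (r119 , []) ∷ (r120 , r119 ∷ []) ∷ [])
      ∷ []) ∷
    node (r0 ∷ r13 ∷ r90 ∷ r108 ∷ r99 ∷ r118 ∷ r119 ∷ []) []
      ( (r113 ,
          (r113 , []) ∷ (r126 , r113 ∷ []) ∷ [])
      ∷ []) ∷
    node (r0 ∷ r13 ∷ r90 ∷ r108 ∷ r99 ∷ r119 ∷ r113 ∷ []) []
      ( (r118 ,
          (r118 , []) ∷ (r121 , r118 ∷ []) ∷ [])
      ∷ []) ∷
    node (r0 ∷ r13 ∷ r90 ∷ r108 ∷ r99 ∷ r119 ∷ r118 ∷ []) []
      ( (r113 ,
          (r113 , []) ∷ (r126 , r113 ∷ []) ∷ [])
      ∷ []) ∷
    node (r0 ∷ r13 ∷ r90 ∷ r108 ∷ r113 ∷ r99 ∷ r118 ∷ []) []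
      ( (r119 ,
          (r119 , []) ∷ (r120 , r119 ∷ []) ∷ [])
      ∷ []) ∷
    node (r0 ∷ r13 ∷ r90 ∷ r108 ∷ r113 ∷ r99 ∷ r119 ∷ []) []
      ( (r118 ,
          (r118 , []) ∷ (r121 , r118 ∷ []) ∷ [])
      ∷ []) ∷
    node (r0 ∷ r13 ∷ r90 ∷ r108 ∷ r113 ∷ r118 ∷ r99 ∷ []) []
      ( (r119 ,
          (r119 , []) ∷ (r120 , r119 ∷ []) ∷ [])
      ∷ []) ∷
    node (r0 ∷ r13 ∷ r90 ∷ r108 ∷ r113 ∷ r118 ∷ r119 ∷ []) []
      ( (r99 ,
          (r99 , []) ∷ (r140 , r99 ∷ []) ∷ [])
      ∷ []) ∷
    node (r0 ∷ r13 ∷ r90 ∷ r108 ∷ r113 ∷ r119 ∷ r99 ∷ []) []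
      ( (r118 ,
          (r118 , []) ∷ (r121 , r118 ∷ []) ∷ [])
      ∷ []) ∷
    node (r0 ∷ r13 ∷ r90 ∷ r108 ∷ r113 ∷ r119 ∷ r118 ∷ []) []
      ( (r99 ,
          (r99 , []) ∷ (r140 , r99 ∷ []) ∷ [])
      ∷ []) ∷
    node (r0 ∷ r13 ∷ r90 ∷ r108 ∷ r118 ∷ r99 ∷ r113 ∷ []) []
      ( (r119 ,
          (r119 , []) ∷ (r120 , r119 ∷ []) ∷ [])
      ∷ []) ∷
    node (r0 ∷ r13 ∷ r90 ∷ r108 ∷ r118 ∷ r99 ∷ r119 ∷ []) []
      ( (r113 ,
          (r113 , []) ∷ (r126 , r113 ∷ []) ∷ [])
      ∷ []) ∷
    node (r0 ∷ r13 ∷ r90 ∷ r108 ∷ r118 ∷ r113 ∷ r99 ∷ []) []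
      ( (r119 ,
          (r119 , []) ∷ (r120 , r119 ∷ []) ∷ [])
      ∷ []) ∷
    node (r0 ∷ r13 ∷ r90 ∷ r108 ∷ r118 ∷ r113 ∷ r119 ∷ []) []
      ( (r99 ,
          (r99 , []) ∷ (r140 , r99 ∷ []) ∷ [])
      ∷ []) ∷
    node (r0 ∷ r13 ∷ r90 ∷ r108 ∷ r118 ∷ r119 ∷ r99 ∷ []) []
      ( (r113 ,
          (r113 , []) ∷ (r126 , r113 ∷ []) ∷ [])
      ∷ []) ∷
    node (r0 ∷ r13 ∷ r90 ∷ r108 ∷ r118 ∷ r119 ∷ r113 ∷ []) []
      ( (r99 ,
          (r99 , []) ∷ (r140 , r99 ∷ []) ∷ [])
      ∷ []) ∷
    node (r0 ∷ r13 ∷ r90 ∷ r108 ∷ r119 ∷ r99 ∷ r113 ∷ []) []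
      ( (r118 ,
          (r118 , []) ∷ (r121 , r118 ∷ []) ∷ [])
      ∷ []) ∷
    node (r0 ∷ r13 ∷ r90 ∷ r108 ∷ r119 ∷ r99 ∷ r118 ∷ []) []
      ( (r113 ,
          (r113 , []) ∷ (r126 , r113 ∷ []) ∷ [])
      ∷ []) ∷
    node (r0 ∷ r13 ∷ r90 ∷ r108 ∷ r119 ∷ r113 ∷ r99 ∷ []) []
      ( (r118 ,
          (r118 , []) ∷ (r121 , r118 ∷ []) ∷ [])
      ∷ []) ∷
    node (r0 ∷ r13 ∷ r90 ∷ r108 ∷ r119 ∷ r113 ∷ r118 ∷ []) []
      ( (r99 ,
          (r99 , []) ∷ (r140 , r99 ∷ []) ∷ [])
      ∷ []) ∷
    node (r0 ∷ r13 ∷ r90 ∷ r108 ∷ r119 ∷ r118 ∷ r99 ∷ []) []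
      ( (r113 ,
          (r113 , []) ∷ (r126 , r113 ∷ []) ∷ [])
      ∷ []) ∷
    node (r0 ∷ r13 ∷ r90 ∷ r108 ∷ r119 ∷ r118 ∷ r113 ∷ []) []
      ( (r99 ,
          (r99 , []) ∷ (r140 , r99 ∷ []) ∷ [])
      ∷ []) ∷
    node (r0 ∷ r13 ∷ r90 ∷ r99 ∷ r108 ∷ r113 ∷ r118 ∷ r119 ∷ []) [] [] ∷
    node (r0 ∷ r13 ∷ r90 ∷ r99 ∷ r108 ∷ r113 ∷ r119 ∷ r118 ∷ []) [] [] ∷
    node (r0 ∷ r13 ∷ r90 ∷ r99 ∷ r108 ∷ r118 ∷ r113 ∷ r119 ∷ []) [] [] ∷
    node (r0 ∷ r13 ∷ r90 ∷ r99 ∷ r108 ∷ r118 ∷ r119 ∷ r113 ∷ []) [] [] ∷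
    node (r0 ∷ r13 ∷ r90 ∷ r99 ∷ r108 ∷ r119 ∷ r113 ∷ r118 ∷ []) [] [] ∷
    node (r0 ∷ r13 ∷ r90 ∷ r99 ∷ r108 ∷ r119 ∷ r118 ∷ r113 ∷ []) [] [] ∷
    node (r0 ∷ r13 ∷ r90 ∷ r108 ∷ r99 ∷ r113 ∷ r118 ∷ r119 ∷ []) [] [] ∷
    node (r0 ∷ r13 ∷ r90 ∷ r108 ∷ r99 ∷ r113 ∷ r119 ∷ r118 ∷ []) [] [] ∷
    node (r0 ∷ r13 ∷ r90 ∷ r108 ∷ r99 ∷ r118 ∷ r113 ∷ r119 ∷ []) [] [] ∷
    node (r0 ∷ r13 ∷ r90 ∷ r108 ∷ r99 ∷ r118 ∷ r119 ∷ r113 ∷ []) [] [] ∷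
    node (r0 ∷ r13 ∷ r90 ∷ r108 ∷ r99 ∷ r119 ∷ r113 ∷ r118 ∷ []) [] [] ∷
    node (r0 ∷ r13 ∷ r90 ∷ r108 ∷ r99 ∷ r119 ∷ r118 ∷ r113 ∷ []) [] [] ∷
    node (r0 ∷ r13 ∷ r90 ∷ r108 ∷ r113 ∷ r99 ∷ r118 ∷ r119 ∷ []) [] [] ∷
    node (r0 ∷ r13 ∷ r90 ∷ r108 ∷ r113 ∷ r99 ∷ r119 ∷ r118 ∷ []) [] [] ∷
    node (r0 ∷ r13 ∷ r90 ∷ r108 ∷ r113 ∷ r118 ∷ r99 ∷ r119 ∷ []) [] [] ∷
    node (r0 ∷ r13 ∷ r90 ∷ r108 ∷ r113 ∷ r118 ∷ r119 ∷ r99 ∷ []) [] [] ∷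
    node (r0 ∷ r13 ∷ r90 ∷ r108 ∷ r113 ∷ r119 ∷ r99 ∷ r118 ∷ []) [] [] ∷
    node (r0 ∷ r13 ∷ r90 ∷ r108 ∷ r113 ∷ r119 ∷ r118 ∷ r99 ∷ []) [] [] ∷
    node (r0 ∷ r13 ∷ r90 ∷ r108 ∷ r118 ∷ r99 ∷ r113 ∷ r119 ∷ []) [] [] ∷
    node (r0 ∷ r13 ∷ r90 ∷ r108 ∷ r118 ∷ r99 ∷ r119 ∷ r113 ∷ []) [] [] ∷
    node (r0 ∷ r13 ∷ r90 ∷ r108 ∷ r118 ∷ r113 ∷ r99 ∷ r119 ∷ []) [] [] ∷
    node (r0 ∷ r13 ∷ r90 ∷ r108 ∷ r118 ∷ r113 ∷ r119 ∷ r99 ∷ []) [] [] ∷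
    node (r0 ∷ r13 ∷ r90 ∷ r108 ∷ r118 ∷ r119 ∷ r99 ∷ r113 ∷ []) [] [] ∷
    node (r0 ∷ r13 ∷ r90 ∷ r108 ∷ r118 ∷ r119 ∷ r113 ∷ r99 ∷ []) [] [] ∷
    node (r0 ∷ r13 ∷ r90 ∷ r108 ∷ r119 ∷ r99 ∷ r113 ∷ r118 ∷ []) [] [] ∷
    node (r0 ∷ r13 ∷ r90 ∷ r108 ∷ r119 ∷ r99 ∷ r118 ∷ r113 ∷ []) [] [] ∷
    node (r0 ∷ r13 ∷ r90 ∷ r108 ∷ r119 ∷ r113 ∷ r99 ∷ r118 ∷ []) [] [] ∷
    node (r0 ∷ r13 ∷ r90 ∷ r108 ∷ r119 ∷ r113 ∷ r118 ∷ r99 ∷ []) [] [] ∷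
    node (r0 ∷ r13 ∷ r90 ∷ r108 ∷ r119 ∷ r118 ∷ r99 ∷ r113 ∷ []) [] [] ∷
    node (r0 ∷ r13 ∷ r90 ∷ r108 ∷ r119 ∷ r118 ∷ r113 ∷ r99 ∷ []) [] [] ∷
    []

  open ListCliques orth using (commonNeighbours)

  isPrefixᵇ : List V8 → Bool
  isPrefixᵇ P = Bool.any (λ N → isYes (List.≡-dec _≟V_ (prefix N) P)) certificate

  validTransporter : List V8 → V8 → V8 × List V8 → Bool
  validTransporter P e (r , w) = Bool.all isRoot w ∧ Bool.all (λ a → Bool.all (orth a) P) w ∧ isYes (actW w r ≟V e)

  validExtension : List V8 → V8 × Orbit → Bool
  validExtension P (e , orbit) =
    e ∈ᵇ commonNeighbours roots P ∧ isPrefixᵇ (P ∷ʳ e) ∧ Bool.all (validTransporter P e) orbit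

  covered : V8 → List (V8 × Orbit) → Bool
  covered r exts = Bool.any (λ (e , orbit) → r ∈ᵇ map proj₁ orbit) exts

  standardizesᵇ : CertificateNode → Bool
  standardizesᵇ (node P u _) =
    if length P ≡ᵇ 5 then Bool.all isRoot u ∧ sameSetᵇ (map (actW u) P) standardClique else true

  extendableᵇ : CertificateNode → Bool
  extendableᵇ (node P _ exts) = if length P <ᵇ 8 then not (null exts) else true

  coveringᵇ : CertificateNode → Bool
  coveringᵇ (node P _ exts) = Bool.all (λ r → covered r exts) (commonNeighbours roots P)

  extensionsValidᵇ : CertificateNode → Bool
  extensionsValidᵇ (node P _ exts) = Bool.all (validExtension P) exts

  validNode : CertificateNode → Bool
  validNode N = standardizesᵇ N ∧ extendableᵇ N ∧ coveringᵇ N ∧ extensionsValidᵇ N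

  certificate-valid : Bool.all validNode certificate ≡ true
  certificate-valid = refl

open Certificate


open ListCliques orth

-- Normal forms of cliques

module NormalForms where

  open import Data.Nat using (ℕ; suc; _≡ᵇ_; _<ᵇ_)

  Represented : List V8 → Set
  Represented P = Any (λ N → prefix N ≡ P) certificate

  Transporter : List V8 → V8 → V8 → List V8 → Set
  Transporter P r e w = RootWord w × All (λ a → All (Adjacent a) P) w × actW w r ≡ e

  private
    split : ∀ {a b} → T (a ∧ b) → T a × T b
    split = Equivalence.to T-∧

    if-true : ∀ {b c} → T (if b then c else true) → T b → T c
    if-true {true} t _ = t

    node-valid : ∀ {N} → N ∈ certificate → T (validNode N)
    node-valid {N} N∈ = Equivalence.from (T-≡ {validNode N}) (all-lookup≡ validNode {certificate} certificate-valid N∈)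

  ∈ᵇ⇒∈ : ∀ {x xs} → T (x ∈ᵇ xs) → x ∈ xs
  ∈ᵇ⇒∈ = toWitness

  isPrefixᵇ⇒Represented : ∀ {P} → T (isPrefixᵇ P) → Represented P
  isPrefixᵇ⇒Represented {P} t =
    Any.map toWitness (any⁻ (λ N → isYes (List.≡-dec _≟V_ (prefix N) P)) certificate t)

  module _ {N} (N∈ : N ∈ certificate) where

    private
      checks : T (standardizesᵇ N) × T (extendableᵇ N) × T (coveringᵇ N) × T (extensionsValidᵇ N)
      checks =
        let (s , v₁) = Equivalence.to (T-∧ {standardizesᵇ N}) (node-valid N∈)
            (e , v₂) = Equivalence.to (T-∧ {extendableᵇ N}) v₁
            (c , x)  = Equivalence.to (T-∧ {coveringᵇ N}) v₂
        in s , e , c , x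
      standardizes = proj₁ checks
      extendable   = proj₁ (proj₂ checks)
      covers       = proj₁ (proj₂ (proj₂ checks))
      extends      = proj₂ (proj₂ (proj₂ checks))

    standardizer-sound : length (prefix N) ≡ 5 →
      RootWord (standardizer N) × SameSet (map (actW (standardizer N)) (prefix N)) standardClique
    standardizer-sound len5 =
      let (u-roots , same) = split (if-true standardizes (ℕ.≡⇒≡ᵇ (length (prefix N)) 5 len5))
          (⊆std , std⊆)    = split same
      in All.map roots-complete (all⁺ isRoot _ u-roots) ,
         λ x → (∈ᵇ⇒∈ ∘ all-lookup (_∈ᵇ standardClique) ⊆std) , (∈ᵇ⇒∈ ∘ all-lookup (_∈ᵇ _) std⊆)

    extension-sound : ∀ {e orbit} → (e , orbit) ∈ extensions N →
      e ∈ commonNeighbours roots (prefix N) × Represented (prefix N ∷ʳ e)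
        × All (λ (r , w) → Transporter (prefix N) r e w) orbit
    extension-sound ext∈ =
      let (e∈ , rest)       = split (all-lookup (validExtension (prefix N)) extends ext∈)
          (represented , ts) = split rest
      in ∈ᵇ⇒∈ e∈ , isPrefixᵇ⇒Represented represented , All.map transporter-sound (all⁺ _ _ ts)
      where
      transporter-sound : ∀ {e rw} → T (validTransporter (prefix N) e rw) → Transporter (prefix N) (proj₁ rw) e (proj₂ rw)
      transporter-sound t =
        let (w-roots , rest) = split t
            (w⊥P , moves)    = split rest
        in All.map roots-complete (all⁺ isRoot _ w-roots) ,
           All.map (λ {a} → all⁺ (orth a) _) (all⁺ (λ a → Bool.all (orth a) (prefix N)) _ w⊥P) ,
           toWitness moves

    extension-exists : length (prefix N) < 8 → Σ (V8 × Orbit) (_∈ extensions N)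
    extension-exists len<8 with extensions N | if-true extendable (ℕ.<⇒<ᵇ len<8)
    ... | ext ∷ _ | _ = ext , here refl

    transport : ∀ {r} → r ∈ commonNeighbours roots (prefix N) →
      Σ (V8 × Orbit) λ ext → ext ∈ extensions N × Σ (List V8) (Transporter (prefix N) r (proj₁ ext))
    transport r∈ =
      let (ext , ext∈ , r∈orbit) = any-find (λ (_ , orbit) → _ ∈ᵇ map proj₁ orbit)
                                     (all-lookup (λ r → covered r (extensions N)) covers r∈)
          ((r′ , w) , rw∈ , r≡r′) = ∈-map⁻ proj₁ (∈ᵇ⇒∈ r∈orbit)
      in ext , ext∈ , w , subst (λ x → Transporter (prefix N) x (proj₁ ext) w) (sym r≡r′)
                            (All.lookup (proj₂ (proj₂ (extension-sound ext∈))) rw∈)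

  FixesPointwise : List V8 → List V8 → Set
  FixesPointwise w P = All (λ p → actW w p ≡ p) P

  orthogonal⇒fixes : ∀ {w P} → All (λ a → All (Adjacent a) P) w → FixesPointwise w P
  orthogonal⇒fixes w⊥P = All.tabulate (λ p∈ → actW-fixes (All.map (λ a⊥P → All.lookup a⊥P p∈) w⊥P))

  fixes-++ : ∀ {u v P} → FixesPointwise u P → FixesPointwise v P → FixesPointwise (u ++ v) P
  fixes-++ {u} {v} uP vP = All.zipWith (λ {p} (up , vp) → trans (actW-++ u v p) (trans (cong (actW u) vp) up)) (uP , vP)

  extend : ∀ {P r} → Represented P → r ∈ commonNeighbours roots P →
    Σ V8 λ e → Σ (List V8) λ w → Transporter P r e w × e ∈ commonNeighbours roots P × Represented (P ∷ʳ e)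
  extend represented r∈ with find represented
  ... | N , N∈ , refl =
    let ((e , _) , ext∈ , w , t) = transport N∈ r∈
        (e∈ , represented′ , _) = extension-sound N∈ ext∈
    in e , w , t , e∈ , represented′

  actW-commonNeighbours : ∀ {w P x} → RootWord w → RootWord P → FixesPointwise w P →
    x ∈ commonNeighbours roots P → actW w x ∈ commonNeighbours roots P
  actW-commonNeighbours {w} {P} {x} w∈ P∈ wP x∈ =
    let (x∈roots , P⊥x) = ∈-commonNeighbours⁻ roots P x∈ in
    ∈-commonNeighbours⁺ roots P (actW-∈roots w∈ x∈roots)
      (All.zipWith (λ {p} ((p∈ , wp≡p) , p⊥x) →
          subst T (trans (sym (actW-orth w∈ p∈ x∈roots)) (cong (λ q → orth q (actW w x)) wp≡p)) p⊥x)
        (All.zip (P∈ , wP) , P⊥x))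

  transport-clique : ∀ {w c C} → RootWord w → All (_∈ roots) (c ∷ C) → All (Adjacent c) C →
    AllPairs Adjacent C → All (Adjacent (actW w c)) (map (actW w) C) × AllPairs Adjacent (map (actW w) C)
  transport-clique {w} {c} w∈ (c∈ ∷ C∈) c⊥C C⊥ = map⁺ (preserve c∈ C∈ c⊥C) , pairs C∈ C⊥
    where
    preserve : ∀ {x xs} → x ∈ roots → All (_∈ roots) xs → All (Adjacent x) xs → All (λ y → Adjacent (actW w x) (actW w y)) xs
    preserve x∈ xs∈ x⊥xs = All.zipWith (λ (y∈ , x⊥y) → subst T (sym (actW-orth w∈ x∈ y∈)) x⊥y) (xs∈ , x⊥xs)
    pairs : ∀ {xs} → All (_∈ roots) xs → AllPairs Adjacent xs → AllPairs Adjacent (map (actW w) xs)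
    pairs []           []            = []
    pairs (x∈ ∷ xs∈) (x⊥xs ∷ xs⊥) = map⁺ (preserve x∈ xs∈ x⊥xs) ∷ pairs xs∈ xs⊥

  extend-clique : ∀ {w P c e C} → RootWord w → RootWord P → FixesPointwise w P → actW w c ≡ e →
    All (_∈ commonNeighbours roots P) (c ∷ C) → All (Adjacent c) C → AllPairs Adjacent C →
    All (_∈ commonNeighbours roots (P ∷ʳ e)) (map (actW w) C) × AllPairs Adjacent (map (actW w) C)
  extend-clique {w} {P} {c} {e} {C} w∈ P∈ wP wc≡e cC∈ c⊥C C⊥ =
    let (e⊥wC , wC⊥) = transport-clique w∈ (All.map roots-of cC∈) c⊥C C⊥ in
    subst (λ Q → All (_∈ Q) (map (actW w) C)) (sym (commonNeighbours-∷ʳ roots P e))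
      (All.zipWith (λ {x} (wx∈ , e⊥wx) → ∈-neighbours⁺ {e} {x} _ wx∈ (subst (λ q → Adjacent q x) wc≡e e⊥wx))
        (map⁺ (All.map (actW-commonNeighbours w∈ P∈ wP) (All.tail cC∈)) , e⊥wC)) ,
    wC⊥
    where
    roots-of : ∀ {x} → x ∈ commonNeighbours roots P → x ∈ roots
    roots-of = proj₁ ∘ ∈-commonNeighbours⁻ roots P

  ∷ʳ-++-actW : ∀ P {e c w₁ w₂} C → actW w₂ e ≡ e → actW w₁ c ≡ e →
    (P ∷ʳ e) ++ map (actW w₂) (map (actW w₁) C) ≡ P ++ map (actW (w₂ ++ w₁)) (c ∷ C)
  ∷ʳ-++-actW P {e} {c} {w₁} {w₂} C w₂e≡e w₁c≡e = begin
    (P ∷ʳ e) ++ map (actW w₂) (map (actW w₁) C) ≡⟨ List.++-assoc P (e ∷ []) _ ⟩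
    P ++ e ∷ map (actW w₂) (map (actW w₁) C)    ≡⟨ cong (λ x → P ++ x ∷ _) e≡ ⟩
    P ++ actW (w₂ ++ w₁) c ∷ map (actW w₂) (map (actW w₁) C)
      ≡⟨ cong (λ xs → P ++ _ ∷ xs) (trans (sym (List.map-∘ C)) (List.map-cong (λ x → sym (actW-++ w₂ w₁ x)) C)) ⟩
    P ++ map (actW (w₂ ++ w₁)) (c ∷ C)           ∎
    where
    open ≡-Reasoning
    e≡ : e ≡ actW (w₂ ++ w₁) c
    e≡ = trans (sym w₂e≡e) (trans (cong (actW w₂) (sym w₁c≡e)) (sym (actW-++ w₂ w₁ c)))

  record NormalForm (P C : List V8) : Set where
    field
      word        : List V8
      rootWord    : RootWord word
      fixes       : FixesPointwise word P
      represented : Represented (P ++ map (actW word) C)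

  normalForm : ∀ {P} C → Represented P → RootWord P → All (_∈ commonNeighbours roots P) C → AllPairs Adjacent C →
    NormalForm P C
  normalForm C = go (length C) C refl
    where
    go : ∀ n {P} C → length C ≡ n → Represented P → RootWord P → All (_∈ commonNeighbours roots P) C →
      AllPairs Adjacent C → NormalForm P C
    go _ {P} [] _ represented _ _ _ =
      record { word = [] ; rootWord = [] ; fixes = All.tabulate (λ _ → refl)
             ; represented = subst Represented (sym (List.++-identityʳ P)) represented }
    go (suc n) {P} (c ∷ C) len represented P∈ cC∈ (c⊥C ∷ C⊥) with extend represented (All.head cC∈)
    ... | e , w₁ , (w₁∈ , w₁⊥P , w₁c≡e) , e∈ , represented′ =
      let w₁P = orthogonal⇒fixes w₁⊥P
          (C′∈ , C′⊥) = extend-clique w₁∈ P∈ w₁P w₁c≡e cC∈ c⊥C C⊥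
          nf = go n (map (actW w₁) C) (trans (List.length-map (actW w₁) C) (ℕ.suc-injective len)) represented′
                 (++⁺ P∈ (proj₁ (∈-commonNeighbours⁻ roots P e∈) ∷ [])) C′∈ C′⊥
          open NormalForm nf renaming (word to w₂; rootWord to w₂∈; fixes to w₂Pe; represented to represented″)
      in record { word = w₂ ++ w₁ ; rootWord = ++⁺ w₂∈ w₁∈ ; fixes = fixes-++ {w₂} {w₁} (++⁻ˡ P w₂Pe) w₁P
                ; represented = subst Represented (∷ʳ-++-actW P {e} {c} {w₁} {w₂} C (All.head (++⁻ʳ P w₂Pe)) w₁c≡e)
                                  represented″ }

open NormalForms


module Cliques where

  open import Data.Integer using (+_)
  open import Data.Nat using (_≡ᵇ_)

  orth-sym : ∀ x y → orth x y ≡ orth y x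
  orth-sym x y = cong (_== + 0) (dot-comm x y)

  pairwiseOrth⇒AllPairs : ∀ {l} → T (pairwiseOrth l) → AllPairs Adjacent l
  pairwiseOrth⇒AllPairs {[]}    _ = []
  pairwiseOrth⇒AllPairs {x ∷ l} t =
    let (x⊥l , l⊥) = Equivalence.to (T-∧ {Bool.all (orth x) l}) t in all⁺ (orth x) l x⊥l ∷ pairwiseOrth⇒AllPairs l⊥

  AllPairs⇒pairwiseOrth : ∀ {l} → AllPairs Adjacent l → T (pairwiseOrth l)
  AllPairs⇒pairwiseOrth {[]}    []          = _
  AllPairs⇒pairwiseOrth {x ∷ l} (x⊥l ∷ l⊥) = Equivalence.from T-∧ (all⁻ (orth x) x⊥l , AllPairs⇒pairwiseOrth l⊥)

  clique-roots : ∀ {C} → T (isClique C) → All (_∈ roots) C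
  clique-roots {C} t = All.map roots-complete (all⁺ isRoot C (proj₁ (Equivalence.to (T-∧ {Bool.all isRoot C}) t)))

  clique-adjacent : ∀ {C} → T (isClique C) → AllPairs Adjacent C
  clique-adjacent {C} t = pairwiseOrth⇒AllPairs (proj₂ (Equivalence.to (T-∧ {Bool.all isRoot C}) t))

  clique-normalForm : ∀ C → T (isClique C) → NormalForm [] C
  clique-normalForm C t = normalForm C (here refl) [] (clique-roots t) (clique-adjacent t)

  root-not-self-orthogonal : ∀ {r} → r ∈ roots → ¬ T (orth r r)
  root-not-self-orthogonal r∈ r⊥r with ==⇒≡ r⊥r
  ... | dot≡0 = contradiction (trans (sym (∈roots⇒norm r∈)) dot≡0)
    where
    contradiction : + 8 ≡ + 0 → ⊥
    contradiction ()

  orth-actW-inverse : ∀ {w e c} → RootWord w → e ∈ roots → c ∈ roots →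
    T (orth (actW w c) e) → T (orth (actW (inverseWord w) e) c)
  orth-actW-inverse {w} {e} {c} w∈ e∈ c∈ = subst T (begin
    orth (actW w c) e                                 ≡⟨ orth-sym (actW w c) e ⟩
    orth e (actW w c)                                 ≡⟨ cong (λ x → orth x (actW w c)) (sym (actW-inverseʳ w∈ e∈)) ⟩
    orth (actW w (actW (inverseWord w) e)) (actW w c) ≡⟨ actW-orth w∈ (actW-∈roots (inverseWord-rootWord w∈) e∈) c∈ ⟩
    orth (actW (inverseWord w) e) c                   ∎)
    where open ≡-Reasoning

  small-clique-extends : ∀ C → T (isClique C) → length C < 8 →
    Σ V8 λ r → r ∈ roots × All (λ c → T (orth r c)) C
  small-clique-extends C t len<8 =
    let open NormalForm (clique-normalForm C t)
        (N , N∈ , prefix≡) = find represented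
        ((e , _) , ext∈) = extension-exists N∈
          (subst (λ Q → length Q < 8) (sym prefix≡) (subst (_< 8) (sym (List.length-map (actW word) C)) len<8))
        (e∈roots , P⊥e) = ∈-commonNeighbours⁻ roots (prefix N) (proj₁ (extension-sound N∈ ext∈))
    in actW (inverseWord word) e , actW-∈roots (inverseWord-rootWord rootWord) e∈roots ,
       All.tabulate (λ {c} c∈C → orth-actW-inverse rootWord e∈roots (All.lookup (clique-roots t) c∈C)
         (All.lookup P⊥e (subst (actW word c ∈_) (sym prefix≡) (∈-map⁺ (actW word) c∈C))))

  clique-not-maximal : ∀ C → T (isClique C) → length C < 8 → ¬ Maximal C
  clique-not-maximal C t len<8 maximal =
    let (r , r∈ , r⊥C) = small-clique-extends C t len<8
    in root-not-self-orthogonal r∈ (All.lookup r⊥C (maximal r (∈roots⇒isRoot r∈) r⊥C))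

  SameSet-sym : ∀ {xs ys} → SameSet xs ys → SameSet ys xs
  SameSet-sym xs~ys x = let (to , from) = xs~ys x in from , to

  SameSet-trans : ∀ {xs ys zs} → SameSet xs ys → SameSet ys zs → SameSet xs zs
  SameSet-trans xs~ys ys~zs x =
    let (to₁ , from₁) = xs~ys x ; (to₂ , from₂) = ys~zs x in to₂ ∘ to₁ , from₁ ∘ from₂

  SameSet-map : ∀ f {xs ys} → SameSet xs ys → SameSet (map f xs) (map f ys)
  SameSet-map f {xs} {ys} xs~ys y = transfer xs~ys , transfer (SameSet-sym xs~ys)
    where
    transfer : ∀ {as bs} → SameSet as bs → y ∈ map f as → y ∈ map f bs
    transfer as~bs y∈ = let (x , x∈ , y≡fx) = ∈-map⁻ f y∈ in
      subst (_∈ map f _) (sym y≡fx) (∈-map⁺ f (proj₁ (as~bs x) x∈))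

  map-actW-++ : ∀ u v C → map (actW (u ++ v)) C ≡ map (actW u) (map (actW v) C)
  map-actW-++ u v C = trans (List.map-cong (actW-++ u v) C) (List.map-∘ C)

  map-actW-inverse : ∀ {w C} → RootWord w → All (_∈ roots) C → map (actW (inverseWord w)) (map (actW w) C) ≡ C
  map-actW-inverse {w} {C} w∈ C∈ =
    trans (sym (List.map-∘ C)) (List.map-id-local (All.map (actW-inverseˡ w∈) C∈))

  clique-standardizer : ∀ C → T (isClique C) → length C ≡ 5 →
    Σ (List V8) λ w → RootWord w × SameSet (map (actW w) C) standardClique
  clique-standardizer C t len5 =
    let open NormalForm (clique-normalForm C t)
        (N , N∈ , prefix≡) = find represented
        (u∈ , u-standardizes) = standardizer-sound N∈
          (subst (λ Q → length Q ≡ 5) (sym prefix≡) (trans (List.length-map (actW word) C) len5))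
    in standardizer N ++ word , ++⁺ u∈ rootWord ,
       subst (λ Q → SameSet Q standardClique)
         (sym (trans (map-actW-++ (standardizer N) word C) (cong (map (actW (standardizer N))) (sym prefix≡))))
         u-standardizes

  cliques-conjugate : ∀ C D → T (isClique C) → T (isClique D) → length C ≡ 5 → length D ≡ 5 →
    Σ (List V8) λ w → T (all isRoot w) × SameSet (map (actW w) C) D
  cliques-conjugate C D tC tD lenC lenD =
    let (u , u∈ , C~std) = clique-standardizer C tC lenC
        (v , v∈ , D~std) = clique-standardizer D tD lenD
        v⁻¹ = inverseWord v
    in v⁻¹ ++ u , all⁻ isRoot (All.map ∈roots⇒isRoot (++⁺ (inverseWord-rootWord v∈) u∈)) ,
       subst (λ Q → SameSet Q D) (sym (map-actW-++ v⁻¹ u C))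
         (SameSet-trans (SameSet-map (actW v⁻¹) C~std)
           (subst (SameSet (map (actW v⁻¹) standardClique)) (map-actW-inverse v∈ (clique-roots tD))
             (SameSet-map (actW v⁻¹) (SameSet-sym D~std))))

  Choice↔Clique : ∀ k → Choice k roots ↔ Clique k
  Choice↔Clique k = Choice↔sortedCliques <ₗ-trans <ₗ-irrefl k roots roots-sorted IsClique T-irrelevant
    (λ {l} t → let (sorted , rest) = Equivalence.to (T-∧ {strictlySorted l}) t
                   (clique , len)  = Equivalence.to (T-∧ {isClique l}) rest
               in strictlySorted⇒AllPairs sorted , clique-roots clique , clique-adjacent clique , ℕ.≡ᵇ⇒≡ _ _ len)
    (λ {l} sorted l⊆ adjacent len → Equivalence.from T-∧ (AllPairs⇒strictlySorted sorted ,
       Equivalence.from T-∧ (Equivalence.from T-∧ (all⁻ isRoot (All.map ∈roots⇒isRoot l⊆) , AllPairs⇒pairwiseOrth adjacent) ,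
         ℕ.≡⇒≡ᵇ _ _ len)))
    where
    IsClique : List V8 → Set
    IsClique l = T (strictlySorted l ∧ isClique l ∧ (length l ≡ᵇ k))

open Cliques

-- Counting

module Counting where

  open import Data.Nat using (ℕ; suc; _*_; NonZero)
  open import Function.Construct.Composition using (_↔-∘_)

  stabilizer-permutes : ∀ {P w} → RootWord w → All (_∈ roots) P → All (λ a → All (Adjacent a) P) w →
    map (actW w) (commonNeighbours roots P) ↭ commonNeighbours roots P
  stabilizer-permutes {P} {w} w∈ P∈ w⊥P =
    commonNeighbours-automorphism (actW w) (actW-orth w∈) {P} {roots} P∈ (All.tabulate (λ x∈ → x∈))
      (List.map-id-local (orthogonal⇒fixes w⊥P)) (actW-permutes-roots {w} w∈)

  transitive-level : ∀ {N e} L → N ∈ certificate → All (_∈ roots) (prefix N) → map proj₁ (extensions N) ≡ e ∷ [] →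
    commonNeighbours roots (prefix N) ≡ L → ∀ k j → k ≡ suc j →
    k * cliqueCount k L ≡ length L * cliqueCount j (neighbours e L)
  transitive-level {N} {e} L N∈ P∈ single refl .(suc j) j refl =
    cliqueCount-vertexTransitive orth-sym j L e (All.tabulate (root-not-self-orthogonal ∘ L⊆roots)) (All.tabulate homogeneous)
    where
    L⊆roots : ∀ {x} → x ∈ L → x ∈ roots
    L⊆roots = proj₁ ∘ ∈-commonNeighbours⁻ roots (prefix N)
    target≡e : ∀ {ext} → ext ∈ extensions N → proj₁ ext ≡ e
    target≡e ext∈ with subst (_ ∈_) single (∈-map⁺ proj₁ ext∈)
    ... | here t≡e = t≡e
    homogeneous : ∀ {s} → s ∈ L → cliqueCount j (neighbours s L) ≡ cliqueCount j (neighbours e L)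
    homogeneous {s} s∈ =
      let ((t , _) , ext∈ , w , w∈ , w⊥P , ws≡t) = transport N∈ s∈ in
      trans (cliqueCount-neighbours-invariant orth-sym (actW w) (actW-orth w∈) j {L} (All.tabulate L⊆roots)
              (stabilizer-permutes w∈ P∈ w⊥P) (L⊆roots s∈))
            (cong (λ x → cliqueCount j (neighbours x L)) (trans ws≡t (target≡e ext∈)))

  L₁ L₂ L₃ : List V8
  L₁ = neighbours r0 roots
  L₂ = neighbours r13 L₁
  L₃ = neighbours r90 L₂

  opaque
    #cliques : ℕ → List V8 → ℕ
    #cliques = cliqueCount

  opaque
    unfolding #cliques

    #cliques≡cliqueCount : #cliques ≡ cliqueCount
    #cliques≡cliqueCount = refl

    L₃-counts : #cliques 2 L₃ ≡ 120 × #cliques 3 L₃ ≡ 240 × #cliques 4 L₃ ≡ 240 × #cliques 5 L₃ ≡ 96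
    L₃-counts = refl , refl , refl , refl


  sealed-level : ∀ {N e} L → N ∈ certificate → All (_∈ roots) (prefix N) → map proj₁ (extensions N) ≡ e ∷ [] →
    commonNeighbours roots (prefix N) ≡ L → ∀ k j → k ≡ suc j →
    k * #cliques k L ≡ length L * #cliques j (neighbours e L)
  sealed-level {e = e} L N∈ P∈ single L≡ k j k≡ =
    subst (λ count → k * count k L ≡ length L * count j (neighbours e L)) (sym #cliques≡cliqueCount)
      (transitive-level L N∈ P∈ single L≡ k j k≡)

  level₀ : ∀ k j → k ≡ suc j → k * #cliques k roots ≡ length roots * #cliques j L₁
  level₀ = sealed-level {e = r0} roots (here refl) [] refl refl

  level₁ : ∀ k j → k ≡ suc j → k * #cliques k L₁ ≡ length L₁ * #cliques j L₂
  level₁ = sealed-level {e = r13} L₁ (there (here refl)) (roots-complete _ ∷ []) refl refl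

  level₂ : ∀ k j → k ≡ suc j → k * #cliques k L₂ ≡ length L₂ * #cliques j L₃
  level₂ = sealed-level {e = r90} L₂ (there (there (here refl))) (roots-complete _ ∷ roots-complete _ ∷ []) refl refl

  count-step : ∀ k a N b v w .{{_ : NonZero k}} → k * a ≡ N * b → b ≡ v → N * v ≡ k * w → a ≡ w
  count-step k a N b v w ka≡Nb b≡v Nv≡kw = ℕ.*-cancelˡ-≡ a w k (trans ka≡Nb (trans (cong (N *_) b≡v) Nv≡kw))

  lift₀ : ∀ k j v w .{{_ : NonZero k}} → k ≡ suc j → #cliques j L₁ ≡ v → length roots * v ≡ k * w → #cliques k roots ≡ w
  lift₀ k j v w k≡ = count-step k (#cliques k roots) (length roots) (#cliques j L₁) v w (level₀ k j k≡)

  lift₁ : ∀ k j v w .{{_ : NonZero k}} → k ≡ suc j → #cliques j L₂ ≡ v → length L₁ * v ≡ k * w → #cliques k L₁ ≡ w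
  lift₁ k j v w k≡ = count-step k (#cliques k L₁) (length L₁) (#cliques j L₂) v w (level₁ k j k≡)

  lift₂ : ∀ k j v w .{{_ : NonZero k}} → k ≡ suc j → #cliques j L₃ ≡ v → length L₂ * v ≡ k * w → #cliques k L₂ ≡ w
  lift₂ k j v w k≡ = count-step k (#cliques k L₂) (length L₂) (#cliques j L₃) v w (level₂ k j k≡)

  clique-counts : #cliques 5 roots ≡ 3628800 × #cliques 6 roots ≡ 3628800
                × #cliques 7 roots ≡ 2073600 × #cliques 8 roots ≡ 518400
  clique-counts =
    lift₀ 5 4 75600 3628800 refl (lift₁ 4 3 2400 75600 refl (lift₂ 3 2 120 2400 refl c₂ refl) refl) refl ,
    lift₀ 6 5 90720 3628800 refl (lift₁ 5 4 3600 90720 refl (lift₂ 4 3 240 3600 refl c₃ refl) refl) refl ,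
    lift₀ 7 6 60480 2073600 refl (lift₁ 6 5 2880 60480 refl (lift₂ 5 4 240 2880 refl c₄ refl) refl) refl ,
    lift₀ 8 7 17280 518400 refl (lift₁ 7 6 960 17280 refl (lift₂ 6 5 96 960 refl c₅ refl) refl) refl
    where
    c₂ = proj₁ L₃-counts
    c₃ = proj₁ (proj₂ L₃-counts)
    c₄ = proj₁ (proj₂ (proj₂ L₃-counts))
    c₅ = proj₂ (proj₂ (proj₂ L₃-counts))

  Fin↔Clique : ∀ k {n} → #cliques k roots ≡ n → Fin n ↔ Clique k
  Fin↔Clique k {n} count≡n = subst (λ m → Fin m ↔ Clique k) count≡n
    (subst (λ count → Fin (count k roots) ↔ Clique k) (sym #cliques≡cliqueCount)
      (Choice↔Clique k ↔-∘ Fin-cliqueCount↔Choice k roots))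

open Counting

theorem4p6 :
  ((C : List V8) → T (isClique C) → length C < 8 → ¬ Maximal C)
  × ((Fin 3628800 ↔ Clique 5) × (Fin 3628800 ↔ Clique 6)
     × (Fin 2073600 ↔ Clique 7) × (Fin 518400 ↔ Clique 8))
  × ((C D : List V8) → T (isClique C) → T (isClique D)
     → length C ≡ 5 → length D ≡ 5
     → Σ (List V8) (λ w → T (all isRoot w) × SameSet (map (actW w) C) D))
theorem4p6 =
  clique-not-maximal ,
  (let (c₅ , c₆ , c₇ , c₈) = clique-counts
   in Fin↔Clique 5 c₅ , Fin↔Clique 6 c₆ , Fin↔Clique 7 c₇ , Fin↔Clique 8 c₈) ,
  cliques-conjugate
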